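{- Let $d\ge 1$ and let $s_1,\dots,s_d$ and $s$ be arbitrary integers. Then the Mordell–Tornheim series $$\zeta_{MT}(s_1,\dots,s_d;s)=\sum_{m_1,\dots,m_d=1}^\infty m_1^{ -s_1}m_2^{ -s_2}\cdots m_d^{ -s_d}(m_1+\cdots+m_d)^{ -s}$$ converges if and only if $s+\sum_{j=1}^{\ell}s_{i_j}>\ell$ for every nonempty subset $\{i_1,\dots,i_\ell\}$ of $\{1,2,\dots,d\}$. -}

module Defs where

open import Data.Nat as ℕ using (ℕ; zero; suc)
open import Data.Integer as ℤ using (ℤ; +_; -[1+_])
open import Data.Rational as ℚ using (ℚ; 0ℚ; 1ℚ)
open import Data.Fin using (Fin; zero; suc)
open import Data.Fin.Subset using (Subset; Nonempty; _∈_)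
open import Data.Bool using (true; false)
open import Data.Vec using (_∷_)
open import Data.Product using (∃-syntax)

sumℕ : ∀ {d} → (Fin d → ℕ) → ℕ
sumℕ {zero} f = 0
sumℕ {suc d} f = f zero ℕ.+ sumℕ (λ i → f (suc i))

prodℚ : ∀ {d} → (Fin d → ℚ) → ℚ
prodℚ {zero} f = 1ℚ
prodℚ {suc d} f = f zero ℚ.* prodℚ (λ i → f (suc i))

-- 1/m as a rational (the value at m = 0 is irrelevant; bases are always ≥ 1)
inv : ℕ → ℚ
inv zero = 0ℚ
inv (suc k) = (+ 1) ℚ./ suc k

negPow : ℕ → ℤ → ℚ
negPow m (+ n) = inv (m ℕ.^ n)
negPow m -[1+ n ] = (+ (m ℕ.^ suc n)) ℚ./ 1

mtTerm : ∀ {d} → (Fin d → ℤ) → ℤ → (Fin d → ℕ) → ℚ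
mtTerm ss s m = prodℚ (λ i → negPow (m i) (ss i)) ℚ.* negPow (sumℕ m) s

sumTo : ℕ → (ℕ → ℚ) → ℚ
sumTo zero f = 0ℚ
sumTo (suc N) f = sumTo N f ℚ.+ f (suc N)

-- Sum of f(m) over all m : Fin d → ℕ with 1 ≤ m_i ≤ N
boxSum : (d N : ℕ) → ((Fin d → ℕ) → ℚ) → ℚ
boxSum zero N f = f (λ ())
boxSum (suc d) N f =
  sumTo N (λ k → boxSum d N (λ g → f (λ { zero → k ; (suc i) → g i })))

mtPartial : (d : ℕ) → (Fin d → ℤ) → ℤ → ℕ → ℚ
mtPartial d ss s N = boxSum d N (mtTerm ss s)

-- A series of nonnegative terms converges iff its partial sums are bounded
MTConverges : (d : ℕ) → (Fin d → ℤ) → ℤ → Set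
MTConverges d ss s = ∃[ B ] (∀ N → mtPartial d ss s N ℚ.≤ B)

subsetSum : ∀ {d} → Subset d → (Fin d → ℤ) → ℤ
subsetSum {zero} _ ss = + 0
subsetSum {suc d} (true ∷ S) ss = ss zero ℤ.+ subsetSum S (λ i → ss (suc i))
subsetSum {suc d} (false ∷ S) ss = subsetSum S (λ i → ss (suc i))

{-# OPTIONS --safe #-}

-- Write the summand as (m_1⋯m_d M)^(-1) · ∏ m_i^(-(s_i-1)) · M^(-(s-1)) with
-- M = m_1 + ⋯ + m_d. The hypothesis says (s-1) + Σ_{i∈S} (s_i-1) ≥ 0 for every nonempty S,
-- which makes the second factor bounded (induction on d, comparing M with the largest m_i).
-- With b = 2^d and ℓ = ⌊log_b⌋ we have ∏ 2^ℓ(m_i) ≤ b^ℓ(M) ≤ M, so the first factor is at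
-- most ∏ w(m_i) for w(x) = 1/(x 2^ℓ(x)); summing w over the blocks [b^k, b^(k+1)) gives a
-- geometric series, so the box partial sums are bounded by a product of bounded sums.
--
-- If s + Σ_{i∈S} s_i ≤ |S| for some nonempty S, consider the boxes where
-- m_i ∈ [2^j, 2^(j+1)) for i ∈ S and m_i = 1 otherwise. On the j-th box every summand is at
-- least a constant times 2^(-j|S|) and the box has 2^(j|S|) points, so each of these disjoint
-- boxes contributes a fixed positive amount and the partial sums are unbounded.

module Submission where

open import Defs
open import Data.Nat as ℕ using (ℕ; zero; suc; _≤_; _<_; z≤n; s≤s; _^_)
import Data.Nat.Properties as ℕP
open import Data.Integer as ℤ using (ℤ; +_; -[1+_])
import Data.Integer.Properties as ℤP
open import Data.Integer.Tactic.RingSolver using (solve-∀)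
open import Data.Rational as ℚ using (ℚ; 0ℚ; 1ℚ; toℚᵘ)
import Data.Rational.Properties as ℚP
open import Data.Rational.Unnormalised as ℚᵘ using (mkℚᵘ; *≡*; *≤*)
import Data.Rational.Unnormalised.Properties as ℚᵘP
open import Data.Fin using (Fin; zero; suc)
open import Data.Fin.Properties using (all?; ¬∀⟶∃¬; toℕ<n)
open import Data.Fin.Subset using (Subset; Nonempty; ∣_∣; ⊥)
open import Data.Vec using (_∷_; []; here; there; lookup)
open import Data.Vec.Properties using ([]=⇒lookup)
open import Data.Vec.Functional using (tail)
open import Data.Bool using (true; false; if_then_else_)
open import Data.Product using (∃; ∃₂; _×_; _,_; proj₁; proj₂)
open import Data.Sum using (_⊎_; inj₁; inj₂)
open import Data.Empty using (⊥-elim)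
open import Function using (_∘_)
open import Function.Bundles using (_⇔_; mk⇔)
open import Relation.Nullary using (Dec; yes; no; ¬_)
open import Relation.Nullary.Decidable using (_×-dec_)
open import Relation.Binary.Definitions using (tri<; tri≈; tri>)
open import Relation.Binary.PropositionalEquality
open import Algebra.Bundles using (CommutativeMonoid)

open import Algebra.Properties.CommutativeSemigroup
  (CommutativeMonoid.commutativeSemigroup ℕP.*-1-commutativeMonoid)
  using () renaming (interchange to ℕ-*-interchange)
open import Algebra.Properties.CommutativeSemigroup
  (CommutativeMonoid.commutativeSemigroup ℚP.*-1-commutativeMonoid)
  using () renaming (interchange to *-interchange)
open import Algebra.Properties.CommutativeSemigroup
  (CommutativeMonoid.commutativeSemigroup ℚP.+-0-commutativeMonoid)
  using () renaming (interchange to +-interchange)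
open import Algebra.Properties.CommutativeSemigroup ℤP.+-commutativeSemigroup
  using () renaming (interchange to ℤ-+-interchange)

^-distribʳ-* : ∀ x y p → (x ℕ.* y) ^ p ≡ x ^ p ℕ.* y ^ p
^-distribʳ-* x y zero = refl
^-distribʳ-* x y (suc p) =
  trans (cong (x ℕ.* y ℕ.*_) (^-distribʳ-* x y p)) (ℕ-*-interchange x y (x ^ p) (y ^ p))

toℚ : ℕ → ℚ
toℚ n = + n ℚ./ 1

private
  toℚᵘ-toℚ : ∀ n → toℚᵘ (toℚ n) ℚᵘ.≃ mkℚᵘ (+ n) 0
  toℚᵘ-toℚ n = ℚP.toℚᵘ-fromℚᵘ (mkℚᵘ (+ n) 0)

  toℚᵘ-inv : ∀ k → toℚᵘ (inv (suc k)) ℚᵘ.≃ mkℚᵘ (+ 1) k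
  toℚᵘ-inv k = ℚP.toℚᵘ-fromℚᵘ (mkℚᵘ (+ 1) k)

  ≤-via-ℚᵘ : ∀ {p q u v} → toℚᵘ p ℚᵘ.≃ u → toℚᵘ q ℚᵘ.≃ v → u ℚᵘ.≤ v → p ℚ.≤ q
  ≤-via-ℚᵘ p≃u q≃v u≤v =
    ℚP.toℚᵘ-cancel-≤ (ℚᵘP.≤-respˡ-≃ (ℚᵘP.≃-sym p≃u) (ℚᵘP.≤-respʳ-≃ (ℚᵘP.≃-sym q≃v) u≤v))

toℚ-+ : ∀ a b → toℚ (a ℕ.+ b) ≡ toℚ a ℚ.+ toℚ b
toℚ-+ a b = ℚP.toℚᵘ-injective (begin
  toℚᵘ (toℚ (a ℕ.+ b))                  ≈⟨ toℚᵘ-toℚ (a ℕ.+ b) ⟩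
  mkℚᵘ (+ (a ℕ.+ b)) 0                  ≈⟨ *≡* (cong (ℤ._* + 1) (sym (cong₂ ℤ._+_ (ℤP.*-identityʳ (+ a)) (ℤP.*-identityʳ (+ b))))) ⟩
  mkℚᵘ (+ a) 0 ℚᵘ.+ mkℚᵘ (+ b) 0        ≈⟨ ℚᵘP.+-cong (toℚᵘ-toℚ a) (toℚᵘ-toℚ b) ⟨
  toℚᵘ (toℚ a) ℚᵘ.+ toℚᵘ (toℚ b)        ≈⟨ ℚP.toℚᵘ-homo-+ (toℚ a) (toℚ b) ⟨
  toℚᵘ (toℚ a ℚ.+ toℚ b)                ∎)
  where open ℚᵘP.≃-Reasoning

toℚ-* : ∀ a b → toℚ (a ℕ.* b) ≡ toℚ a ℚ.* toℚ b
toℚ-* a b = ℚP.toℚᵘ-injective (begin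
  toℚᵘ (toℚ (a ℕ.* b))                  ≈⟨ toℚᵘ-toℚ (a ℕ.* b) ⟩
  mkℚᵘ (+ (a ℕ.* b)) 0                  ≈⟨ *≡* (cong (ℤ._* + 1) (ℤP.pos-* a b)) ⟩
  mkℚᵘ (+ a) 0 ℚᵘ.* mkℚᵘ (+ b) 0        ≈⟨ ℚᵘP.*-cong (toℚᵘ-toℚ a) (toℚᵘ-toℚ b) ⟨
  toℚᵘ (toℚ a) ℚᵘ.* toℚᵘ (toℚ b)        ≈⟨ ℚP.toℚᵘ-homo-* (toℚ a) (toℚ b) ⟨
  toℚᵘ (toℚ a ℚ.* toℚ b)                ∎)
  where open ℚᵘP.≃-Reasoning

inv-* : ∀ a b → inv (a ℕ.* b) ≡ inv a ℚ.* inv b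
inv-* zero    b       = sym (ℚP.*-zeroˡ (inv b))
inv-* (suc a) zero    = trans (cong inv (ℕP.*-zeroʳ a)) (sym (ℚP.*-zeroʳ (inv (suc a))))
inv-* (suc a) (suc b) = ℚP.toℚᵘ-injective (begin
  toℚᵘ (inv (suc a ℕ.* suc b))          ≈⟨ toℚᵘ-inv (b ℕ.+ a ℕ.* suc b) ⟩
  mkℚᵘ (+ 1) (b ℕ.+ a ℕ.* suc b)        ≈⟨ *≡* refl ⟩
  mkℚᵘ (+ 1) a ℚᵘ.* mkℚᵘ (+ 1) b        ≈⟨ ℚᵘP.*-cong (toℚᵘ-inv a) (toℚᵘ-inv b) ⟨
  toℚᵘ (inv (suc a)) ℚᵘ.* toℚᵘ (inv (suc b)) ≈⟨ ℚP.toℚᵘ-homo-* (inv (suc a)) (inv (suc b)) ⟨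
  toℚᵘ (inv (suc a) ℚ.* inv (suc b))    ∎)
  where open ℚᵘP.≃-Reasoning

inv*toℚ : ∀ n → 1 ≤ n → inv n ℚ.* toℚ n ≡ 1ℚ
inv*toℚ (suc k) _ = ℚP.toℚᵘ-injective (begin
  toℚᵘ (inv (suc k) ℚ.* toℚ (suc k))           ≈⟨ ℚP.toℚᵘ-homo-* (inv (suc k)) (toℚ (suc k)) ⟩
  toℚᵘ (inv (suc k)) ℚᵘ.* toℚᵘ (toℚ (suc k))   ≈⟨ ℚᵘP.*-cong (toℚᵘ-inv k) (toℚᵘ-toℚ (suc k)) ⟩
  mkℚᵘ (+ 1) k ℚᵘ.* mkℚᵘ (+ suc k) 0           ≈⟨ *≡* (ℤP.*-assoc (+ 1) (+ suc k) (+ 1)) ⟩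
  toℚᵘ 1ℚ                                      ∎)
  where open ℚᵘP.≃-Reasoning

toℚ*inv : ∀ n → 1 ≤ n → toℚ n ℚ.* inv n ≡ 1ℚ
toℚ*inv n 1≤n = trans (ℚP.*-comm (toℚ n) (inv n)) (inv*toℚ n 1≤n)

toℚ-mono-≤ : ∀ {a b} → a ≤ b → toℚ a ℚ.≤ toℚ b
toℚ-mono-≤ {a} {b} a≤b =
  ≤-via-ℚᵘ (toℚᵘ-toℚ a) (toℚᵘ-toℚ b) (*≤* (ℤP.*-monoʳ-≤-nonNeg (+ 1) (ℤ.+≤+ a≤b)))

toℚ-nonNeg : ∀ n → 0ℚ ℚ.≤ toℚ n
toℚ-nonNeg n = toℚ-mono-≤ {0} {n} z≤n

inv-antimono-≤ : ∀ {a b} → 1 ≤ a → a ≤ b → inv b ℚ.≤ inv a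
inv-antimono-≤ {suc a} {suc b} _ a≤b =
  ≤-via-ℚᵘ (toℚᵘ-inv b) (toℚᵘ-inv a) (*≤* (ℤP.*-monoˡ-≤-nonNeg (+ 1) (ℤ.+≤+ a≤b)))

inv-nonNeg : ∀ n → 0ℚ ℚ.≤ inv n
inv-nonNeg zero    = ℚP.≤-refl
inv-nonNeg (suc k) = ≤-via-ℚᵘ (toℚᵘ-toℚ 0) (toℚᵘ-inv k) (*≤* (ℤ.+≤+ z≤n))

inv-≤-1 : ∀ n → inv n ℚ.≤ 1ℚ
inv-≤-1 zero    = inv-nonNeg 1
inv-≤-1 (suc k) = inv-antimono-≤ {1} {suc k} ℕP.≤-refl (s≤s z≤n)

*-monoˡ-≤-0≤ : ∀ {p q} r → 0ℚ ℚ.≤ r → p ℚ.≤ q → r ℚ.* p ℚ.≤ r ℚ.* q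
*-monoˡ-≤-0≤ r 0≤r = ℚP.*-monoˡ-≤-nonNeg r {{ℚ.nonNegative 0≤r}}

*-monoʳ-≤-0≤ : ∀ {p q} r → 0ℚ ℚ.≤ r → p ℚ.≤ q → p ℚ.* r ℚ.≤ q ℚ.* r
*-monoʳ-≤-0≤ r 0≤r = ℚP.*-monoʳ-≤-nonNeg r {{ℚ.nonNegative 0≤r}}

*-mono-≤-0≤ : ∀ {p q r s} → 0ℚ ℚ.≤ p → 0ℚ ℚ.≤ r → p ℚ.≤ q → r ℚ.≤ s → p ℚ.* r ℚ.≤ q ℚ.* s
*-mono-≤-0≤ {q = q} {r} 0≤p 0≤r p≤q r≤s =
  ℚP.≤-trans (*-monoʳ-≤-0≤ r 0≤r p≤q) (*-monoˡ-≤-0≤ q (ℚP.≤-trans 0≤p p≤q) r≤s)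

0≤* : ∀ {p q} → 0ℚ ℚ.≤ p → 0ℚ ℚ.≤ q → 0ℚ ℚ.≤ p ℚ.* q
0≤* {p} {q} 0≤p 0≤q = ℚP.≤-trans (ℚP.≤-reflexive (sym (ℚP.*-zeroˡ q))) (*-monoʳ-≤-0≤ q 0≤q 0≤p)

a≤1⇒a*p≤p : ∀ {a} p → 0ℚ ℚ.≤ p → a ℚ.≤ 1ℚ → a ℚ.* p ℚ.≤ p
a≤1⇒a*p≤p p 0≤p a≤1 = ℚP.≤-trans (*-monoʳ-≤-0≤ p 0≤p a≤1) (ℚP.≤-reflexive (ℚP.*-identityˡ p))

1≤^ : ∀ {x} n → 1 ≤ x → 1 ≤ x ^ n
1≤^ {suc k} n _ = ℕP.m^n>0 (suc k) n

1<2^ : ∀ {d} → 1 ≤ d → 1 < 2 ^ d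
1<2^ {d} 1≤d = ℕP.^-monoʳ-< 2 (s≤s (s≤s z≤n)) {0} {d} 1≤d

negPow-nonNeg : ∀ x e → 0ℚ ℚ.≤ negPow x e
negPow-nonNeg x (+ n)    = inv-nonNeg (x ^ n)
negPow-nonNeg x -[1+ n ] = toℚ-nonNeg (x ^ suc n)

negPow-≤-1 : ∀ x {e} → + 0 ℤ.≤ e → negPow x e ℚ.≤ 1ℚ
negPow-≤-1 x {+ n} _ = inv-≤-1 (x ^ n)

negPow-1 : ∀ e → negPow 1 e ≡ 1ℚ
negPow-1 (+ n)    = cong inv (ℕP.^-zeroˡ n)
negPow-1 -[1+ n ] = cong toℚ (ℕP.^-zeroˡ (suc n))

negPow-+1 : ∀ x → negPow x (+ 1) ≡ inv x
negPow-+1 x = cong inv (ℕP.*-identityʳ x)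

negPow-antimonoˡ : ∀ {x y} n → 1 ≤ x → x ≤ y → negPow y (+ n) ℚ.≤ negPow x (+ n)
negPow-antimonoˡ n 1≤x x≤y = inv-antimono-≤ (1≤^ n 1≤x) (ℕP.^-monoˡ-≤ n x≤y)

negPow-monoˡ-nonPos : ∀ {x y e} → e ℤ.≤ + 0 → x ≤ y → negPow x e ℚ.≤ negPow y e
negPow-monoˡ-nonPos {e = + 0}      _ _   = ℚP.≤-refl
negPow-monoˡ-nonPos {e = + suc n}  (ℤ.+≤+ ()) _
negPow-monoˡ-nonPos {e = -[1+ n ]} _ x≤y = toℚ-mono-≤ (ℕP.^-monoˡ-≤ (suc n) x≤y)

negPow-* : ∀ x y e → negPow (x ℕ.* y) e ≡ negPow x e ℚ.* negPow y e
negPow-* x y (+ n)    = trans (cong inv (^-distribʳ-* x y n)) (inv-* (x ^ n) (y ^ n))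
negPow-* x y -[1+ n ] = trans (cong toℚ (^-distribʳ-* x y (suc n))) (toℚ-* (x ^ suc n) (y ^ suc n))

ℤ-difference : ∀ e → ∃₂ λ p q → e ℤ.+ + q ≡ + p
ℤ-difference (+ n)    = n , 0 , cong +_ (ℕP.+-identityʳ n)
ℤ-difference -[1+ n ] = 0 , suc n , ℤP.+-inverseˡ (+ suc n)

-[1+n]+q≡p⇒q≡p+1+n : ∀ n {p q} → -[1+ n ] ℤ.+ + q ≡ + p → q ≡ p ℕ.+ suc n
-[1+n]+q≡p⇒q≡p+1+n n {p} {q} eq = ℤP.+-injective (trans (move (+ suc n) (+ q)) (cong (ℤ._+ + suc n) eq))
  where
  move : ∀ (a b : ℤ) → b ≡ (ℤ.- a ℤ.+ b) ℤ.+ a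
  move = solve-∀

negPow-as-ratio : ∀ {x} e {p q} → 1 ≤ x → e ℤ.+ + q ≡ + p → negPow x e ≡ toℚ (x ^ q) ℚ.* inv (x ^ p)
negPow-as-ratio {x} (+ n) {q = q} 1≤x eq with ℤP.+-injective eq
... | refl = sym (begin
  toℚ (x ^ q) ℚ.* inv (x ^ (n ℕ.+ q))             ≡⟨ cong (λ z → toℚ (x ^ q) ℚ.* inv z) (ℕP.^-distribˡ-+-* x n q) ⟩
  toℚ (x ^ q) ℚ.* inv (x ^ n ℕ.* x ^ q)           ≡⟨ cong (toℚ (x ^ q) ℚ.*_) (trans (inv-* (x ^ n) (x ^ q)) (ℚP.*-comm (inv (x ^ n)) (inv (x ^ q)))) ⟩
  toℚ (x ^ q) ℚ.* (inv (x ^ q) ℚ.* inv (x ^ n))   ≡⟨ ℚP.*-assoc (toℚ (x ^ q)) (inv (x ^ q)) (inv (x ^ n)) ⟨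
  (toℚ (x ^ q) ℚ.* inv (x ^ q)) ℚ.* inv (x ^ n)   ≡⟨ cong (ℚ._* inv (x ^ n)) (toℚ*inv (x ^ q) (1≤^ q 1≤x)) ⟩
  1ℚ ℚ.* inv (x ^ n)                              ≡⟨ ℚP.*-identityˡ _ ⟩
  inv (x ^ n)                                     ∎)
  where open ≡-Reasoning
negPow-as-ratio {x} -[1+ n ] {p} {q} 1≤x eq with -[1+n]+q≡p⇒q≡p+1+n n {p} {q} eq
... | refl = sym (begin
  toℚ (x ^ (p ℕ.+ suc n)) ℚ.* inv (x ^ p)         ≡⟨ cong (λ z → toℚ z ℚ.* inv (x ^ p)) (ℕP.^-distribˡ-+-* x p (suc n)) ⟩
  toℚ (x ^ p ℕ.* x ^ suc n) ℚ.* inv (x ^ p)       ≡⟨ cong (ℚ._* inv (x ^ p)) (trans (toℚ-* (x ^ p) (x ^ suc n)) (ℚP.*-comm (toℚ (x ^ p)) (toℚ (x ^ suc n)))) ⟩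
  (toℚ (x ^ suc n) ℚ.* toℚ (x ^ p)) ℚ.* inv (x ^ p) ≡⟨ ℚP.*-assoc (toℚ (x ^ suc n)) (toℚ (x ^ p)) (inv (x ^ p)) ⟩
  toℚ (x ^ suc n) ℚ.* (toℚ (x ^ p) ℚ.* inv (x ^ p)) ≡⟨ cong (toℚ (x ^ suc n) ℚ.*_) (toℚ*inv (x ^ p) (1≤^ p 1≤x)) ⟩
  toℚ (x ^ suc n) ℚ.* 1ℚ                          ≡⟨ ℚP.*-identityʳ _ ⟩
  toℚ (x ^ suc n)                                 ∎)
  where open ≡-Reasoning

negPow-+ : ∀ {x} a b → 1 ≤ x → negPow x (a ℤ.+ b) ≡ negPow x a ℚ.* negPow x b
negPow-+ {x} a b 1≤x with ℤ-difference a | ℤ-difference b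
... | pa , qa , eqa | pb , qb , eqb = begin
  negPow x (a ℤ.+ b)                                        ≡⟨ negPow-as-ratio (a ℤ.+ b) 1≤x eq ⟩
  toℚ (x ^ (qa ℕ.+ qb)) ℚ.* inv (x ^ (pa ℕ.+ pb))           ≡⟨ cong₂ (λ u v → toℚ u ℚ.* inv v) (ℕP.^-distribˡ-+-* x qa qb) (ℕP.^-distribˡ-+-* x pa pb) ⟩
  toℚ (x ^ qa ℕ.* x ^ qb) ℚ.* inv (x ^ pa ℕ.* x ^ pb)       ≡⟨ cong₂ ℚ._*_ (toℚ-* (x ^ qa) (x ^ qb)) (inv-* (x ^ pa) (x ^ pb)) ⟩
  (toℚ (x ^ qa) ℚ.* toℚ (x ^ qb)) ℚ.* (inv (x ^ pa) ℚ.* inv (x ^ pb)) ≡⟨ *-interchange (toℚ (x ^ qa)) (toℚ (x ^ qb)) (inv (x ^ pa)) (inv (x ^ pb)) ⟩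
  (toℚ (x ^ qa) ℚ.* inv (x ^ pa)) ℚ.* (toℚ (x ^ qb) ℚ.* inv (x ^ pb)) ≡⟨ cong₂ ℚ._*_ (negPow-as-ratio a 1≤x eqa) (negPow-as-ratio b 1≤x eqb) ⟨
  negPow x a ℚ.* negPow x b                                 ∎
  where
  open ≡-Reasoning
  eq : (a ℤ.+ b) ℤ.+ + (qa ℕ.+ qb) ≡ + (pa ℕ.+ pb)
  eq = trans (ℤ-+-interchange a b (+ qa) (+ qb)) (cong₂ ℤ._+_ eqa eqb)

negPow-pred : ∀ {x} e → 1 ≤ x → negPow x e ≡ inv x ℚ.* negPow x (e ℤ.- + 1)
negPow-pred {x} e 1≤x = begin
  negPow x e                                  ≡⟨ cong (negPow x) (split e) ⟩
  negPow x (+ 1 ℤ.+ (e ℤ.- + 1))              ≡⟨ negPow-+ (+ 1) (e ℤ.- + 1) 1≤x ⟩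
  negPow x (+ 1) ℚ.* negPow x (e ℤ.- + 1)     ≡⟨ cong (ℚ._* negPow x (e ℤ.- + 1)) (negPow-+1 x) ⟩
  inv x ℚ.* negPow x (e ℤ.- + 1)              ∎
  where
  open ≡-Reasoning
  split : ∀ (e : ℤ) → e ≡ + 1 ℤ.+ (e ℤ.- + 1)
  split = solve-∀

negPow-antimonoʳ : ∀ {x} e j → 1 ≤ x → negPow x (e ℤ.+ + j) ℚ.≤ negPow x e
negPow-antimonoʳ {x} e j 1≤x = begin
  negPow x (e ℤ.+ + j)            ≡⟨ negPow-+ e (+ j) 1≤x ⟩
  negPow x e ℚ.* negPow x (+ j)   ≤⟨ *-monoˡ-≤-0≤ (negPow x e) (negPow-nonNeg x e) (negPow-≤-1 x {+ j} (ℤ.+≤+ z≤n)) ⟩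
  negPow x e ℚ.* 1ℚ               ≡⟨ ℚP.*-identityʳ _ ⟩
  negPow x e                      ∎
  where open ℚP.≤-Reasoning

negPow-≥-scaled : ∀ {A y x} e → 1 ≤ A → 1 ≤ y → y ≤ x → x ≤ A ℕ.* y →
                  inv (A ^ ℤ.∣ e ∣) ℚ.* negPow y e ℚ.≤ negPow x e
negPow-≥-scaled {A} {y} {x} (+ n) 1≤A 1≤y y≤x x≤Ay = begin
  inv (A ^ n) ℚ.* negPow y (+ n)   ≡⟨ negPow-* A y (+ n) ⟨
  negPow (A ℕ.* y) (+ n)           ≤⟨ negPow-antimonoˡ n (ℕP.≤-trans 1≤y y≤x) x≤Ay ⟩
  negPow x (+ n)                   ∎
  where open ℚP.≤-Reasoning
negPow-≥-scaled {A} {y} {x} e@(-[1+ n ]) 1≤A 1≤y y≤x x≤Ay = begin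
  inv (A ^ suc n) ℚ.* negPow y e   ≤⟨ *-monoʳ-≤-0≤ (negPow y e) (negPow-nonNeg y e) (inv-≤-1 (A ^ suc n)) ⟩
  1ℚ ℚ.* negPow y e                ≡⟨ ℚP.*-identityˡ _ ⟩
  negPow y e                       ≤⟨ negPow-monoˡ-nonPos {e = e} ℤ.-≤+ y≤x ⟩
  negPow x e                       ∎
  where open ℚP.≤-Reasoning

prodℕ : ∀ {d} → (Fin d → ℕ) → ℕ
prodℕ {zero}  f = 1
prodℕ {suc d} f = f zero ℕ.* prodℕ (tail f)

1≤prodℕ : ∀ {d} (f : Fin d → ℕ) → (∀ i → 1 ≤ f i) → 1 ≤ prodℕ f
1≤prodℕ {zero}  f 1≤f = s≤s z≤n
1≤prodℕ {suc d} f 1≤f = ℕP.*-mono-≤ (1≤f zero) (1≤prodℕ (tail f) (1≤f ∘ suc))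

prodℕ-≤-^ : ∀ {d} (f : Fin d → ℕ) X → (∀ i → f i ≤ X) → prodℕ f ≤ X ^ d
prodℕ-≤-^ {zero}  f X f≤X = ℕP.≤-refl
prodℕ-≤-^ {suc d} f X f≤X = ℕP.*-mono-≤ (f≤X zero) (prodℕ-≤-^ (tail f) X (f≤X ∘ suc))

≤-sumℕ : ∀ {d} (m : Fin d → ℕ) i → m i ≤ sumℕ m
≤-sumℕ m zero    = ℕP.m≤m+n (m zero) (sumℕ (tail m))
≤-sumℕ m (suc i) = ℕP.≤-trans (≤-sumℕ (tail m) i) (ℕP.m≤n+m (sumℕ (tail m)) (m zero))

sumℕ-≤-* : ∀ {d} (m : Fin d → ℕ) X → (∀ i → m i ≤ X) → sumℕ m ≤ d ℕ.* X
sumℕ-≤-* {zero}  m X m≤X = z≤n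
sumℕ-≤-* {suc d} m X m≤X = ℕP.+-mono-≤ (m≤X zero) (sumℕ-≤-* (tail m) X (m≤X ∘ suc))

prodℚ-cong : ∀ {d} {f g : Fin d → ℚ} → (∀ i → f i ≡ g i) → prodℚ f ≡ prodℚ g
prodℚ-cong {zero}  f≡g = refl
prodℚ-cong {suc d} f≡g = cong₂ ℚ._*_ (f≡g zero) (prodℚ-cong (f≡g ∘ suc))

prodℚ-* : ∀ {d} (f g : Fin d → ℚ) → prodℚ (λ i → f i ℚ.* g i) ≡ prodℚ f ℚ.* prodℚ g
prodℚ-* {zero}  f g = refl
prodℚ-* {suc d} f g = trans (cong (f zero ℚ.* g zero ℚ.*_) (prodℚ-* (tail f) (tail g)))
                            (*-interchange (f zero) (g zero) (prodℚ (tail f)) (prodℚ (tail g)))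

prodℚ-nonNeg : ∀ {d} (f : Fin d → ℚ) → (∀ i → 0ℚ ℚ.≤ f i) → 0ℚ ℚ.≤ prodℚ f
prodℚ-nonNeg {zero}  f 0≤f = inv-nonNeg 1
prodℚ-nonNeg {suc d} f 0≤f = 0≤* (0≤f zero) (prodℚ-nonNeg (tail f) (0≤f ∘ suc))

prodℚ-mono-≤ : ∀ {d} (f g : Fin d → ℚ) → (∀ i → 0ℚ ℚ.≤ f i) → (∀ i → f i ℚ.≤ g i) → prodℚ f ℚ.≤ prodℚ g
prodℚ-mono-≤ {zero}  f g 0≤f f≤g = ℚP.≤-refl
prodℚ-mono-≤ {suc d} f g 0≤f f≤g =
  *-mono-≤-0≤ (0≤f zero) (prodℚ-nonNeg (tail f) (0≤f ∘ suc)) (f≤g zero) (prodℚ-mono-≤ (tail f) (tail g) (0≤f ∘ suc) (f≤g ∘ suc))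

prodℚ-inv : ∀ {d} (f : Fin d → ℕ) → prodℚ (λ i → inv (f i)) ≡ inv (prodℕ f)
prodℚ-inv {zero}  f = refl
prodℚ-inv {suc d} f = trans (cong (inv (f zero) ℚ.*_) (prodℚ-inv (tail f))) (sym (inv-* (f zero) (prodℕ (tail f))))

prodℚ-toℚ : ∀ {d} (f : Fin d → ℕ) → prodℚ (λ i → toℚ (f i)) ≡ toℚ (prodℕ f)
prodℚ-toℚ {zero}  f = refl
prodℚ-toℚ {suc d} f = trans (cong (toℚ (f zero) ℚ.*_) (prodℚ-toℚ (tail f))) (sym (toℚ-* (f zero) (prodℕ (tail f))))

prodℚ-1 : ∀ {d} (f : Fin d → ℚ) → (∀ i → f i ≡ 1ℚ) → prodℚ f ≡ 1ℚ
prodℚ-1 {zero}  f f≡1 = refl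
prodℚ-1 {suc d} f f≡1 = cong₂ ℚ._*_ (f≡1 zero) (prodℚ-1 (tail f) (f≡1 ∘ suc))

prodℚ-0 : ∀ {d} (f : Fin d → ℚ) i → f i ≡ 0ℚ → prodℚ f ≡ 0ℚ
prodℚ-0 f zero    f0≡0 = trans (cong (ℚ._* prodℚ (tail f)) f0≡0) (ℚP.*-zeroˡ (prodℚ (tail f)))
prodℚ-0 f (suc i) fi≡0 = trans (cong (f zero ℚ.*_) (prodℚ-0 (tail f) i fi≡0)) (ℚP.*-zeroʳ (f zero))

sumTo-cong : ∀ N {f g : ℕ → ℚ} → (∀ k → 1 ≤ k → k ≤ N → f k ≡ g k) → sumTo N f ≡ sumTo N g
sumTo-cong zero    f≡g = refl
sumTo-cong (suc N) f≡g =
  cong₂ ℚ._+_ (sumTo-cong N (λ k 1≤k k≤N → f≡g k 1≤k (ℕP.m≤n⇒m≤1+n k≤N))) (f≡g (suc N) (s≤s z≤n) ℕP.≤-refl)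

sumTo-mono-≤ : ∀ N {f g : ℕ → ℚ} → (∀ k → 1 ≤ k → f k ℚ.≤ g k) → sumTo N f ℚ.≤ sumTo N g
sumTo-mono-≤ zero    f≤g = ℚP.≤-refl
sumTo-mono-≤ (suc N) f≤g = ℚP.+-mono-≤ (sumTo-mono-≤ N f≤g) (f≤g (suc N) (s≤s z≤n))

sumTo-nonNeg : ∀ N (f : ℕ → ℚ) → (∀ k → 1 ≤ k → 0ℚ ℚ.≤ f k) → 0ℚ ℚ.≤ sumTo N f
sumTo-nonNeg zero    f 0≤f = ℚP.≤-refl
sumTo-nonNeg (suc N) f 0≤f = ℚP.+-mono-≤ (sumTo-nonNeg N f 0≤f) (0≤f (suc N) (s≤s z≤n))

sumTo-*ˡ : ∀ N c (f : ℕ → ℚ) → sumTo N (λ k → c ℚ.* f k) ≡ c ℚ.* sumTo N f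
sumTo-*ˡ zero    c f = sym (ℚP.*-zeroʳ c)
sumTo-*ˡ (suc N) c f =
  trans (cong (ℚ._+ c ℚ.* f (suc N)) (sumTo-*ˡ N c f)) (sym (ℚP.*-distribˡ-+ c (sumTo N f) (f (suc N))))

sumTo-*ʳ : ∀ N c (f : ℕ → ℚ) → sumTo N (λ k → f k ℚ.* c) ≡ sumTo N f ℚ.* c
sumTo-*ʳ N c f = trans (sumTo-cong N (λ k _ _ → ℚP.*-comm (f k) c))
                       (trans (sumTo-*ˡ N c f) (ℚP.*-comm c (sumTo N f)))

sumTo-+ : ∀ N (f g : ℕ → ℚ) → sumTo N (λ k → f k ℚ.+ g k) ≡ sumTo N f ℚ.+ sumTo N g
sumTo-+ zero    f g = refl
sumTo-+ (suc N) f g = trans (cong (ℚ._+ (f (suc N) ℚ.+ g (suc N))) (sumTo-+ N f g))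
                            (+-interchange (sumTo N f) (sumTo N g) (f (suc N)) (g (suc N)))

sumTo-const : ∀ N c → sumTo N (λ _ → c) ≡ toℚ N ℚ.* c
sumTo-const zero    c = sym (ℚP.*-zeroˡ c)
sumTo-const (suc N) c = begin
  sumTo N (λ _ → c) ℚ.+ c          ≡⟨ cong₂ ℚ._+_ (sumTo-const N c) (sym (ℚP.*-identityˡ c)) ⟩
  toℚ N ℚ.* c ℚ.+ 1ℚ ℚ.* c         ≡⟨ ℚP.*-distribʳ-+ c (toℚ N) 1ℚ ⟨
  (toℚ N ℚ.+ toℚ 1) ℚ.* c          ≡⟨ cong (ℚ._* c) (toℚ-+ N 1) ⟨
  toℚ (N ℕ.+ 1) ℚ.* c              ≡⟨ cong (λ n → toℚ n ℚ.* c) (ℕP.+-comm N 1) ⟩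
  toℚ (suc N) ℚ.* c                ∎
  where open ≡-Reasoning

sumTo-0 : ∀ N {f : ℕ → ℚ} → (∀ k → 1 ≤ k → k ≤ N → f k ≡ 0ℚ) → sumTo N f ≡ 0ℚ
sumTo-0 N f≡0 = trans (sumTo-cong N f≡0) (trans (sumTo-const N 0ℚ) (ℚP.*-zeroʳ (toℚ N)))

sumTo-split : ∀ j N (f : ℕ → ℚ) → sumTo (j ℕ.+ N) f ≡ sumTo N f ℚ.+ sumTo j (λ k → f (k ℕ.+ N))
sumTo-split zero    N f = sym (ℚP.+-identityʳ (sumTo N f))
sumTo-split (suc j) N f = trans (cong (ℚ._+ f (suc j ℕ.+ N)) (sumTo-split j N f))
                                (ℚP.+-assoc (sumTo N f) (sumTo j (λ k → f (k ℕ.+ N))) (f (suc j ℕ.+ N)))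

sumTo-monoˡ-≤ : ∀ {N N'} (f : ℕ → ℚ) → (∀ k → 1 ≤ k → 0ℚ ℚ.≤ f k) → N ≤ N' → sumTo N f ℚ.≤ sumTo N' f
sumTo-monoˡ-≤ {N} {N'} f 0≤f N≤N' = begin
  sumTo N f                                           ≡⟨ ℚP.+-identityʳ (sumTo N f) ⟨
  sumTo N f ℚ.+ 0ℚ                                    ≤⟨ ℚP.+-monoʳ-≤ (sumTo N f) (sumTo-nonNeg j _ (λ k 1≤k → 0≤f (k ℕ.+ N) (ℕP.≤-trans 1≤k (ℕP.m≤m+n k N)))) ⟩
  sumTo N f ℚ.+ sumTo j (λ k → f (k ℕ.+ N))           ≡⟨ sumTo-split j N f ⟨
  sumTo (j ℕ.+ N) f                                   ≡⟨ cong (λ n → sumTo n f) (ℕP.m∸n+n≡m N≤N') ⟩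
  sumTo N' f                                          ∎
  where
  open ℚP.≤-Reasoning
  j = N' ℕ.∸ N

AllPositive : ∀ {d} → (Fin d → ℕ) → Set
AllPositive m = ∀ i → 1 ≤ m i

1≤sumℕ : ∀ {d} (m : Fin d → ℕ) → 1 ≤ d → AllPositive m → 1 ≤ sumℕ m
1≤sumℕ {suc d} m _ m⁺ = ℕP.≤-trans (m⁺ zero) (≤-sumℕ m zero)

boxSum-cong : ∀ d N {f g : (Fin d → ℕ) → ℚ} → (∀ m → AllPositive m → f m ≡ g m) → boxSum d N f ≡ boxSum d N g
boxSum-cong zero    N f≡g = f≡g _ (λ ())
boxSum-cong (suc d) N f≡g =
  sumTo-cong N (λ k 1≤k _ → boxSum-cong d N (λ m m⁺ → f≡g _ (λ { zero → 1≤k ; (suc i) → m⁺ i })))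

boxSum-mono-≤ : ∀ d N {f g : (Fin d → ℕ) → ℚ} → (∀ m → AllPositive m → f m ℚ.≤ g m) → boxSum d N f ℚ.≤ boxSum d N g
boxSum-mono-≤ zero    N f≤g = f≤g _ (λ ())
boxSum-mono-≤ (suc d) N f≤g =
  sumTo-mono-≤ N (λ k 1≤k → boxSum-mono-≤ d N (λ m m⁺ → f≤g _ (λ { zero → 1≤k ; (suc i) → m⁺ i })))

boxSum-*ˡ : ∀ d N c (f : (Fin d → ℕ) → ℚ) → boxSum d N (λ m → c ℚ.* f m) ≡ c ℚ.* boxSum d N f
boxSum-*ˡ zero    N c f = refl
boxSum-*ˡ (suc d) N c f = trans (sumTo-cong N (λ k _ _ → boxSum-*ˡ d N c _)) (sumTo-*ˡ N c _)

boxSum-+ : ∀ d N (f g : (Fin d → ℕ) → ℚ) → boxSum d N (λ m → f m ℚ.+ g m) ≡ boxSum d N f ℚ.+ boxSum d N g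
boxSum-+ zero    N f g = refl
boxSum-+ (suc d) N f g = trans (sumTo-cong N (λ k _ _ → boxSum-+ d N _ _)) (sumTo-+ N _ _)

boxSum-sumTo : ∀ d N J (f : ℕ → (Fin d → ℕ) → ℚ) →
               boxSum d N (λ m → sumTo J (λ j → f j m)) ≡ sumTo J (λ j → boxSum d N (f j))
boxSum-sumTo d N zero    f = trans (boxSum-*ˡ d N 0ℚ (λ _ → 0ℚ)) (ℚP.*-zeroˡ (boxSum d N (λ _ → 0ℚ)))
boxSum-sumTo d N (suc J) f =
  trans (boxSum-+ d N (λ m → sumTo J (λ j → f j m)) (f (suc J))) (cong (ℚ._+ boxSum d N (f (suc J))) (boxSum-sumTo d N J f))

boxSum-prod : ∀ d N (h : Fin d → ℕ → ℚ) → boxSum d N (λ m → prodℚ (λ i → h i (m i))) ≡ prodℚ (λ i → sumTo N (h i))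
boxSum-prod zero    N h = refl
boxSum-prod (suc d) N h = begin
  sumTo N (λ k → boxSum d N (λ m → h zero k ℚ.* prodℚ (λ i → h (suc i) (m i))))
    ≡⟨ sumTo-cong N (λ k _ _ → boxSum-*ˡ d N (h zero k) (λ m → prodℚ (λ i → h (suc i) (m i)))) ⟩
  sumTo N (λ k → h zero k ℚ.* boxSum d N (λ m → prodℚ (λ i → h (suc i) (m i))))
    ≡⟨ sumTo-*ʳ N _ (h zero) ⟩
  sumTo N (h zero) ℚ.* boxSum d N (λ m → prodℚ (λ i → h (suc i) (m i)))
    ≡⟨ cong (sumTo N (h zero) ℚ.*_) (boxSum-prod d N (tail h)) ⟩
  sumTo N (h zero) ℚ.* prodℚ (λ i → sumTo N (h (suc i)))
    ∎
  where open ≡-Reasoning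

-- Dyadic weights

∸+pred : ∀ {u v} → 1 ≤ u → u ≤ v → (v ℕ.∸ u) ℕ.+ ℕ.pred u ≡ ℕ.pred v
∸+pred {suc u} {v} _ u≤v = cong ℕ.pred (trans (sym (ℕP.+-suc (v ℕ.∸ suc u) u)) (ℕP.m∸n+n≡m u≤v))

-- ⌊log_b n⌋, with the junk value 0 at n = 0.
⌊log⌋ : ℕ → ℕ → ℕ
⌊log⌋ b zero = 0
⌊log⌋ b (suc n) with b ^ suc (⌊log⌋ b n) ℕ.≤? suc n
... | yes _ = suc (⌊log⌋ b n)
... | no  _ = ⌊log⌋ b n

-- For b = 2^d the factor 2^⌊log_b x⌋ stands in for the irrational x^(1/d).
dyadicWeight : ℕ → ℕ → ℚ
dyadicWeight b x = inv x ℚ.* inv (2 ^ ⌊log⌋ b x)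

dyadicWeight-nonNeg : ∀ b x → 0ℚ ℚ.≤ dyadicWeight b x
dyadicWeight-nonNeg b x = 0≤* (inv-nonNeg x) (inv-nonNeg (2 ^ ⌊log⌋ b x))

module _ {b : ℕ} (1<b : 1 < b) where

  private
    1≤b : 1 ≤ b
    1≤b = ℕP.<⇒≤ 1<b

    b^-mono-≤ : ∀ {j k} → j ≤ k → b ^ j ≤ b ^ k
    b^-mono-≤ = ℕP.^-monoʳ-≤ b {{ℕ.>-nonZero 1≤b}}

    b^<b^suc : ∀ k → b ^ k < b ^ suc k
    b^<b^suc k = ℕP.^-monoʳ-< b 1<b (ℕP.n<1+n k)

  ⌊log⌋-spec : ∀ n → n < b ^ suc (⌊log⌋ b n) × (1 ≤ n → b ^ ⌊log⌋ b n ≤ n)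
  ⌊log⌋-spec zero = 1≤^ 1 1≤b , λ ()
  ⌊log⌋-spec (suc n) with b ^ suc (⌊log⌋ b n) ℕ.≤? suc n | ⌊log⌋-spec n
  ... | yes b^L⁺≤n⁺ | n<b^L⁺ , _     = ℕP.<-≤-trans (s≤s n<b^L⁺) (b^<b^suc (suc (⌊log⌋ b n))) , λ _ → b^L⁺≤n⁺
  ... | no  b^L⁺≰n⁺ | _      , b^L≤n = ℕP.≰⇒> b^L⁺≰n⁺ , λ _ → b^L≤n⁺ n b^L≤n
    where
    b^L≤n⁺ : ∀ n → (1 ≤ n → b ^ ⌊log⌋ b n ≤ n) → b ^ ⌊log⌋ b n ≤ suc n
    b^L≤n⁺ zero    _     = ℕP.≤-refl
    b^L≤n⁺ (suc n) b^L≤n = ℕP.m≤n⇒m≤1+n (b^L≤n (s≤s z≤n))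

  b^⌊log⌋≤ : ∀ n → 1 ≤ n → b ^ ⌊log⌋ b n ≤ n
  b^⌊log⌋≤ n = proj₂ (⌊log⌋-spec n)

  ≤⌊log⌋ : ∀ k n → b ^ k ≤ n → k ≤ ⌊log⌋ b n
  ≤⌊log⌋ k n b^k≤n with k ℕ.≤? ⌊log⌋ b n
  ... | yes k≤L = k≤L
  ... | no  k≰L = ⊥-elim (ℕP.<-irrefl refl
          (ℕP.<-≤-trans (proj₁ (⌊log⌋-spec n)) (ℕP.≤-trans (b^-mono-≤ (ℕP.≰⇒> k≰L)) b^k≤n)))

  ⌊log⌋-mono-≤ : ∀ {m n} → 1 ≤ m → m ≤ n → ⌊log⌋ b m ≤ ⌊log⌋ b n
  ⌊log⌋-mono-≤ {m} {n} 1≤m m≤n = ≤⌊log⌋ (⌊log⌋ b m) n (ℕP.≤-trans (b^⌊log⌋≤ m 1≤m) m≤n)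

  n<b^n : ∀ n → n < b ^ n
  n<b^n zero    = s≤s z≤n
  n<b^n (suc n) = ℕP.<-≤-trans (s≤s (n<b^n n)) (b^<b^suc n)

  dyadicWeight-≤ : ∀ k x → b ^ k ≤ x → dyadicWeight b x ℚ.≤ inv (b ^ k) ℚ.* inv (2 ^ k)
  dyadicWeight-≤ k x b^k≤x =
    *-mono-≤-0≤ (inv-nonNeg x) (inv-nonNeg (2 ^ ⌊log⌋ b x))
      (inv-antimono-≤ (1≤^ k 1≤b) b^k≤x)
      (inv-antimono-≤ (1≤^ k (s≤s z≤n)) (ℕP.^-monoʳ-≤ 2 (≤⌊log⌋ k x b^k≤x)))

  sumTo-dyadicWeight-block : ∀ k →
    sumTo (ℕ.pred (b ^ suc k)) (dyadicWeight b) ℚ.≤ sumTo (ℕ.pred (b ^ k)) (dyadicWeight b) ℚ.+ toℚ b ℚ.* inv (2 ^ k)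
  sumTo-dyadicWeight-block k = begin
    sumTo (ℕ.pred v) w                             ≡⟨ cong (λ N → sumTo N w) (∸+pred 1≤u u≤v) ⟨
    sumTo (n ℕ.+ ℕ.pred u) w                       ≡⟨ sumTo-split n (ℕ.pred u) w ⟩
    sumTo (ℕ.pred u) w ℚ.+ sumTo n (λ j → w (j ℕ.+ ℕ.pred u))
      ≤⟨ ℚP.+-monoʳ-≤ (sumTo (ℕ.pred u) w) (sumTo-mono-≤ n (λ j 1≤j → dyadicWeight-≤ k _ (u≤j+pred-u j 1≤j))) ⟩
    sumTo (ℕ.pred u) w ℚ.+ sumTo n (λ _ → c)       ≡⟨ cong (sumTo (ℕ.pred u) w ℚ.+_) (sumTo-const n c) ⟩
    sumTo (ℕ.pred u) w ℚ.+ toℚ n ℚ.* c             ≤⟨ ℚP.+-monoʳ-≤ (sumTo (ℕ.pred u) w) n*c≤ ⟩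
    sumTo (ℕ.pred u) w ℚ.+ toℚ b ℚ.* inv (2 ^ k)   ∎
    where
    open ℚP.≤-Reasoning
    w = dyadicWeight b
    u = b ^ k
    v = b ^ suc k
    n = v ℕ.∸ u
    c = inv u ℚ.* inv (2 ^ k)
    1≤u : 1 ≤ u
    1≤u = 1≤^ k 1≤b
    u≤v : u ≤ v
    u≤v = ℕP.<⇒≤ (b^<b^suc k)
    u≤j+pred-u : ∀ j → 1 ≤ j → u ≤ j ℕ.+ ℕ.pred u
    u≤j+pred-u j 1≤j = ℕP.≤-trans (ℕP.≤-reflexive (sym (ℕP.suc-pred u {{ℕ.>-nonZero 1≤u}}))) (ℕP.+-monoˡ-≤ (ℕ.pred u) 1≤j)
    n*c≤ : toℚ n ℚ.* c ℚ.≤ toℚ b ℚ.* inv (2 ^ k)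
    n*c≤ = begin
      toℚ n ℚ.* (inv u ℚ.* inv (2 ^ k))            ≡⟨ ℚP.*-assoc (toℚ n) (inv u) (inv (2 ^ k)) ⟨
      (toℚ n ℚ.* inv u) ℚ.* inv (2 ^ k)
        ≤⟨ *-monoʳ-≤-0≤ (inv (2 ^ k)) (inv-nonNeg (2 ^ k)) (*-monoʳ-≤-0≤ (inv u) (inv-nonNeg u) (toℚ-mono-≤ (ℕP.m∸n≤m v u))) ⟩
      (toℚ (b ℕ.* u) ℚ.* inv u) ℚ.* inv (2 ^ k)    ≡⟨ cong (λ q → (q ℚ.* inv u) ℚ.* inv (2 ^ k)) (toℚ-* b u) ⟩
      ((toℚ b ℚ.* toℚ u) ℚ.* inv u) ℚ.* inv (2 ^ k) ≡⟨ cong (ℚ._* inv (2 ^ k)) (ℚP.*-assoc (toℚ b) (toℚ u) (inv u)) ⟩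
      (toℚ b ℚ.* (toℚ u ℚ.* inv u)) ℚ.* inv (2 ^ k) ≡⟨ cong (λ q → (toℚ b ℚ.* q) ℚ.* inv (2 ^ k)) (toℚ*inv u 1≤u) ⟩
      (toℚ b ℚ.* 1ℚ) ℚ.* inv (2 ^ k)               ≡⟨ cong (ℚ._* inv (2 ^ k)) (ℚP.*-identityʳ (toℚ b)) ⟩
      toℚ b ℚ.* inv (2 ^ k)                        ∎

  -- The k-th block contributes at most b/2^k, so this is the bound Σ_{i<k} b/2^i = 2b - 2b/2^k.
  sumTo-dyadicWeight-prefix : ∀ k →
    sumTo (ℕ.pred (b ^ k)) (dyadicWeight b) ℚ.+ toℚ (2 ℕ.* b) ℚ.* inv (2 ^ k) ℚ.≤ toℚ (2 ℕ.* b)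
  sumTo-dyadicWeight-prefix zero = ℚP.≤-reflexive (trans (ℚP.+-identityˡ _) (ℚP.*-identityʳ (toℚ (2 ℕ.* b))))
  sumTo-dyadicWeight-prefix (suc k) = begin
    S (suc k) ℚ.+ toℚ (2 ℕ.* b) ℚ.* inv (2 ^ suc k)  ≤⟨ ℚP.+-monoˡ-≤ _ (sumTo-dyadicWeight-block k) ⟩
    (S k ℚ.+ t) ℚ.+ toℚ (2 ℕ.* b) ℚ.* inv (2 ^ suc k) ≡⟨ cong ((S k ℚ.+ t) ℚ.+_) halve ⟩
    (S k ℚ.+ t) ℚ.+ t                                ≡⟨ ℚP.+-assoc (S k) t t ⟩
    S k ℚ.+ (t ℚ.+ t)                                ≡⟨ cong (S k ℚ.+_) double ⟩
    S k ℚ.+ toℚ (2 ℕ.* b) ℚ.* inv (2 ^ k)            ≤⟨ sumTo-dyadicWeight-prefix k ⟩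
    toℚ (2 ℕ.* b)                                    ∎
    where
    open ℚP.≤-Reasoning
    S : ℕ → ℚ
    S k = sumTo (ℕ.pred (b ^ k)) (dyadicWeight b)
    t = toℚ b ℚ.* inv (2 ^ k)
    halve : toℚ (2 ℕ.* b) ℚ.* inv (2 ^ suc k) ≡ t
    halve = begin-equality
      toℚ (2 ℕ.* b) ℚ.* inv (2 ℕ.* 2 ^ k)                      ≡⟨ cong₂ ℚ._*_ (toℚ-* 2 b) (inv-* 2 (2 ^ k)) ⟩
      (toℚ 2 ℚ.* toℚ b) ℚ.* (inv 2 ℚ.* inv (2 ^ k))            ≡⟨ *-interchange (toℚ 2) (toℚ b) (inv 2) (inv (2 ^ k)) ⟩
      (toℚ 2 ℚ.* inv 2) ℚ.* t                                  ≡⟨ cong (ℚ._* t) (toℚ*inv 2 (s≤s z≤n)) ⟩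
      1ℚ ℚ.* t                                                 ≡⟨ ℚP.*-identityˡ t ⟩
      t                                                        ∎
    double : t ℚ.+ t ≡ toℚ (2 ℕ.* b) ℚ.* inv (2 ^ k)
    double = begin-equality
      t ℚ.+ t                                    ≡⟨ ℚP.*-distribʳ-+ (inv (2 ^ k)) (toℚ b) (toℚ b) ⟨
      (toℚ b ℚ.+ toℚ b) ℚ.* inv (2 ^ k)          ≡⟨ cong (ℚ._* inv (2 ^ k)) (toℚ-+ b b) ⟨
      toℚ (b ℕ.+ b) ℚ.* inv (2 ^ k)              ≡⟨ cong (λ n → toℚ (b ℕ.+ n) ℚ.* inv (2 ^ k)) (ℕP.+-identityʳ b) ⟨
      toℚ (2 ℕ.* b) ℚ.* inv (2 ^ k)              ∎

  sumTo-dyadicWeight-≤ : ∀ N → sumTo N (dyadicWeight b) ℚ.≤ toℚ (2 ℕ.* b)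
  sumTo-dyadicWeight-≤ N = begin
    sumTo N w                                              ≤⟨ sumTo-monoˡ-≤ w (λ x _ → dyadicWeight-nonNeg b x) (ℕP.<⇒≤pred (n<b^n N)) ⟩
    sumTo (ℕ.pred (b ^ N)) w                               ≡⟨ ℚP.+-identityʳ _ ⟨
    sumTo (ℕ.pred (b ^ N)) w ℚ.+ 0ℚ                        ≤⟨ ℚP.+-monoʳ-≤ (sumTo (ℕ.pred (b ^ N)) w) (0≤* (toℚ-nonNeg (2 ℕ.* b)) (inv-nonNeg (2 ^ N))) ⟩
    sumTo (ℕ.pred (b ^ N)) w ℚ.+ toℚ (2 ℕ.* b) ℚ.* inv (2 ^ N) ≤⟨ sumTo-dyadicWeight-prefix N ⟩
    toℚ (2 ℕ.* b)                                          ∎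
    where
    open ℚP.≤-Reasoning
    w = dyadicWeight b

-- Convergence

negPowProd : ∀ {d} → (Fin d → ℕ) → (Fin d → ℤ) → ℚ
negPowProd m cs = prodℚ (λ i → negPow (m i) (cs i))

negPowProd-nonNeg : ∀ {d} (m : Fin d → ℕ) cs → 0ℚ ℚ.≤ negPowProd m cs
negPowProd-nonNeg m cs = prodℚ-nonNeg _ (λ i → negPow-nonNeg (m i) (cs i))

NonNegSubsetSums : ∀ {d} → ℤ → (Fin d → ℤ) → Set
NonNegSubsetSums {d} c cs = ∀ (S : Subset d) → Nonempty S → + 0 ℤ.≤ c ℤ.+ subsetSum S cs

subsetSum-⊥ : ∀ {d} (cs : Fin d → ℤ) → subsetSum ⊥ cs ≡ + 0
subsetSum-⊥ {zero}  cs = refl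
subsetSum-⊥ {suc d} cs = subsetSum-⊥ (tail cs)

module _ {d} (c : ℤ) (cs : Fin (suc d) → ℤ) (sums≥0 : NonNegSubsetSums c cs) where

  nonNegSubsetSums-tail : NonNegSubsetSums c (tail cs)
  nonNegSubsetSums-tail S (i , i∈S) = sums≥0 (false ∷ S) (suc i , there i∈S)

  nonNegSubsetSums-absorb : NonNegSubsetSums (c ℤ.+ cs zero) (tail cs)
  nonNegSubsetSums-absorb S (i , i∈S) =
    subst (+ 0 ℤ.≤_) (sym (ℤP.+-assoc c (cs zero) _)) (sums≥0 (true ∷ S) (suc i , there i∈S))

  nonNegSubsetSums-head : + 0 ℤ.≤ c ℤ.+ cs zero
  nonNegSubsetSums-head = subst (+ 0 ℤ.≤_) c+cs₀+0≡c+cs₀ (sums≥0 (true ∷ ⊥) (zero , here))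
    where
    c+cs₀+0≡c+cs₀ : c ℤ.+ (cs zero ℤ.+ subsetSum ⊥ (tail cs)) ≡ c ℤ.+ cs zero
    c+cs₀+0≡c+cs₀ = cong (λ σ → c ℤ.+ (cs zero ℤ.+ σ)) (subsetSum-⊥ (tail cs))
                  ■ cong (λ σ → c ℤ.+ σ) (ℤP.+-identityʳ (cs zero))
      where _■_ = trans

negPow-*-negPowProd-≤-1 : ∀ {d} c (cs : Fin d → ℤ) (m : Fin d → ℕ) Y →
  NonNegSubsetSums c cs → + 0 ℤ.≤ c → AllPositive m → (∀ i → m i ≤ Y) →
  negPow Y c ℚ.* negPowProd m cs ℚ.≤ 1ℚ
negPow-*-negPowProd-≤-1 {zero} c cs m Y _ 0≤c _ _ =
  ℚP.≤-trans (ℚP.≤-reflexive (ℚP.*-identityʳ (negPow Y c))) (negPow-≤-1 Y 0≤c)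
negPow-*-negPowProd-≤-1 {suc d} c cs m Y sums≥0 0≤c m⁺ m≤Y with + 0 ℤ.≤? cs zero
... | yes 0≤cs₀ = begin
  negPow Y c ℚ.* (negPow (m zero) (cs zero) ℚ.* P)   ≤⟨ *-monoˡ-≤-0≤ (negPow Y c) (negPow-nonNeg Y c) (a≤1⇒a*p≤p P (negPowProd-nonNeg (tail m) (tail cs)) (negPow-≤-1 (m zero) 0≤cs₀)) ⟩
  negPow Y c ℚ.* P                                   ≤⟨ negPow-*-negPowProd-≤-1 c (tail cs) (tail m) Y (nonNegSubsetSums-tail c cs sums≥0) 0≤c (m⁺ ∘ suc) (m≤Y ∘ suc) ⟩
  1ℚ                                                 ∎
  where
  open ℚP.≤-Reasoning
  P = negPowProd (tail m) (tail cs)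
... | no 0≰cs₀ = begin
  negPow Y c ℚ.* (negPow (m zero) (cs zero) ℚ.* P)   ≡⟨ ℚP.*-assoc (negPow Y c) _ P ⟨
  (negPow Y c ℚ.* negPow (m zero) (cs zero)) ℚ.* P   ≤⟨ *-monoʳ-≤-0≤ P (negPowProd-nonNeg (tail m) (tail cs)) (*-monoˡ-≤-0≤ (negPow Y c) (negPow-nonNeg Y c) (negPow-monoˡ-nonPos cs₀≤0 (m≤Y zero))) ⟩
  (negPow Y c ℚ.* negPow Y (cs zero)) ℚ.* P          ≡⟨ cong (ℚ._* P) (negPow-+ c (cs zero) (ℕP.≤-trans (m⁺ zero) (m≤Y zero))) ⟨
  negPow Y (c ℤ.+ cs zero) ℚ.* P                     ≤⟨ negPow-*-negPowProd-≤-1 (c ℤ.+ cs zero) (tail cs) (tail m) Y (nonNegSubsetSums-absorb c cs sums≥0) (nonNegSubsetSums-head c cs sums≥0) (m⁺ ∘ suc) (m≤Y ∘ suc) ⟩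
  1ℚ                                                 ∎
  where
  open ℚP.≤-Reasoning
  P = negPowProd (tail m) (tail cs)
  cs₀≤0 : cs zero ℤ.≤ + 0
  cs₀≤0 = ℤP.<⇒≤ (ℤP.≰⇒> 0≰cs₀)

-- Either m₀ is at most the sum R of the other coordinates, so M ≤ 2R and we recurse,
-- or m₀ dominates: M ≤ 2m₀, and M^(-c) is absorbed into m₀^(-cs₀) for the previous lemma.
negPow-sumℕ-*-negPowProd-≤ : ∀ {d} c (cs : Fin d → ℤ) (m : Fin d → ℕ) →
  NonNegSubsetSums c cs → AllPositive m →
  negPow (sumℕ m) c ℚ.* negPowProd m cs ℚ.≤ toℚ ((2 ^ d) ^ ℤ.∣ c ∣)
negPow-sumℕ-*-negPowProd-≤ {d} (+ n) cs m sums≥0 m⁺ = ℚP.≤-trans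
  (negPow-*-negPowProd-≤-1 (+ n) cs m (sumℕ m) sums≥0 (ℤ.+≤+ z≤n) m⁺ (≤-sumℕ m))
  (toℚ-mono-≤ {1} {(2 ^ d) ^ n} (1≤^ n (1≤^ d (s≤s z≤n))))
negPow-sumℕ-*-negPowProd-≤ {zero} -[1+ n ] cs m _ _ =
  ℚP.≤-trans (ℚP.≤-reflexive (ℚP.*-identityʳ (toℚ 0))) (toℚ-mono-≤ {0} {1 ^ suc n} z≤n)
negPow-sumℕ-*-negPowProd-≤ {suc d} c@(-[1+ n ]) cs m sums≥0 m⁺ with m zero ℕ.≤? sumℕ (tail m)
... | yes m₀≤R = begin
  negPow M c ℚ.* (a ℚ.* P)                  ≤⟨ *-monoˡ-≤-0≤ (negPow M c) (negPow-nonNeg M c) (a≤1⇒a*p≤p P P≥0 (negPow-≤-1 (m zero) 0≤cs₀)) ⟩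
  negPow M c ℚ.* P                          ≤⟨ *-monoʳ-≤-0≤ P P≥0 (negPow-monoˡ-nonPos {e = c} ℤ.-≤+ M≤2R) ⟩
  negPow (2 ℕ.* R) c ℚ.* P                  ≡⟨ cong (ℚ._* P) (negPow-* 2 R c) ⟩
  (negPow 2 c ℚ.* negPow R c) ℚ.* P         ≡⟨ ℚP.*-assoc (negPow 2 c) (negPow R c) P ⟩
  negPow 2 c ℚ.* (negPow R c ℚ.* P)         ≤⟨ *-monoˡ-≤-0≤ (negPow 2 c) (negPow-nonNeg 2 c)
                                                 (negPow-sumℕ-*-negPowProd-≤ c (tail cs) (tail m) (nonNegSubsetSums-tail c cs sums≥0) (m⁺ ∘ suc)) ⟩
  toℚ (2 ^ suc n) ℚ.* toℚ ((2 ^ d) ^ suc n) ≡⟨ toℚ-* (2 ^ suc n) ((2 ^ d) ^ suc n) ⟨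
  toℚ (2 ^ suc n ℕ.* (2 ^ d) ^ suc n)       ≡⟨ cong toℚ (^-distribʳ-* 2 (2 ^ d) (suc n)) ⟨
  toℚ ((2 ^ suc d) ^ suc n)                 ∎
  where
  open ℚP.≤-Reasoning
  M = sumℕ m
  R = sumℕ (tail m)
  a = negPow (m zero) (cs zero)
  P = negPowProd (tail m) (tail cs)
  P≥0 = negPowProd-nonNeg (tail m) (tail cs)
  0≤cs₀ : + 0 ℤ.≤ cs zero
  0≤cs₀ = ℤP.≤-trans (nonNegSubsetSums-head c cs sums≥0)
            (ℤP.≤-trans (ℤP.+-monoˡ-≤ (cs zero) (ℤ.-≤+ {n} {0})) (ℤP.≤-reflexive (ℤP.+-identityˡ (cs zero))))
  M≤2R : M ≤ 2 ℕ.* R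
  M≤2R = ℕP.≤-trans (ℕP.+-monoˡ-≤ R m₀≤R) (ℕP.≤-reflexive (cong (R ℕ.+_) (sym (ℕP.+-identityʳ R))))
... | no m₀≰R = begin
  negPow M c ℚ.* (a ℚ.* P)                          ≤⟨ *-monoʳ-≤-0≤ (a ℚ.* P) (0≤* (negPow-nonNeg m₀ (cs zero)) P≥0) (negPow-monoˡ-nonPos {e = c} ℤ.-≤+ M≤2m₀) ⟩
  negPow (2 ℕ.* m₀) c ℚ.* (a ℚ.* P)                 ≡⟨ cong (ℚ._* (a ℚ.* P)) (negPow-* 2 m₀ c) ⟩
  (negPow 2 c ℚ.* negPow m₀ c) ℚ.* (a ℚ.* P)        ≡⟨ ℚP.*-assoc (negPow 2 c) (negPow m₀ c) (a ℚ.* P) ⟩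
  negPow 2 c ℚ.* (negPow m₀ c ℚ.* (a ℚ.* P))        ≡⟨ cong (negPow 2 c ℚ.*_) (ℚP.*-assoc (negPow m₀ c) a P) ⟨
  negPow 2 c ℚ.* ((negPow m₀ c ℚ.* a) ℚ.* P)        ≡⟨ cong (λ q → negPow 2 c ℚ.* (q ℚ.* P)) (negPow-+ c (cs zero) (m⁺ zero)) ⟨
  negPow 2 c ℚ.* (negPow m₀ (c ℤ.+ cs zero) ℚ.* P)  ≤⟨ *-monoˡ-≤-0≤ (negPow 2 c) (negPow-nonNeg 2 c)
                                                         (negPow-*-negPowProd-≤-1 (c ℤ.+ cs zero) (tail cs) (tail m) m₀
                                                           (nonNegSubsetSums-absorb c cs sums≥0) (nonNegSubsetSums-head c cs sums≥0) (m⁺ ∘ suc) tail≤m₀) ⟩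
  negPow 2 c ℚ.* 1ℚ                                 ≡⟨ ℚP.*-identityʳ (negPow 2 c) ⟩
  toℚ (2 ^ suc n)                                   ≤⟨ toℚ-mono-≤ (ℕP.^-monoˡ-≤ (suc n) (ℕP.*-monoʳ-≤ 2 (1≤^ d (s≤s z≤n)))) ⟩
  toℚ ((2 ^ suc d) ^ suc n)                         ∎
  where
  open ℚP.≤-Reasoning
  m₀ = m zero
  M = sumℕ m
  R = sumℕ (tail m)
  a = negPow m₀ (cs zero)
  P = negPowProd (tail m) (tail cs)
  P≥0 = negPowProd-nonNeg (tail m) (tail cs)
  R<m₀ : R < m₀
  R<m₀ = ℕP.≰⇒> m₀≰R
  tail≤m₀ : ∀ i → m (suc i) ≤ m₀
  tail≤m₀ i = ℕP.≤-trans (≤-sumℕ (tail m) i) (ℕP.<⇒≤ R<m₀)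
  M≤2m₀ : M ≤ 2 ℕ.* m₀
  M≤2m₀ = ℕP.≤-trans (ℕP.+-monoʳ-≤ m₀ (ℕP.<⇒≤ R<m₀)) (ℕP.≤-reflexive (cong (m₀ ℕ.+_) (sym (ℕP.+-identityʳ m₀))))

inv-sumℕ-≤-prod : ∀ {d} (m : Fin d → ℕ) → 1 ≤ d → AllPositive m →
                  inv (sumℕ m) ℚ.≤ prodℚ (λ i → inv (2 ^ ⌊log⌋ (2 ^ d) (m i)))
inv-sumℕ-≤-prod {suc d} m _ m⁺ = begin
  inv M                      ≤⟨ inv-antimono-≤ (1≤prodℕ f (λ i → 1≤^ (ℓ (m i)) (s≤s z≤n))) ∏f≤M ⟩
  inv (prodℕ f)              ≡⟨ prodℚ-inv f ⟨
  prodℚ (λ i → inv (f i))    ∎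
  where
  open ℚP.≤-Reasoning
  b = 2 ^ suc d
  1<b : 1 < b
  1<b = 1<2^ {suc d} (s≤s z≤n)
  ℓ = ⌊log⌋ b
  M = sumℕ m
  f = λ i → 2 ^ ℓ (m i)
  ∏f≤M : prodℕ f ≤ M
  ∏f≤M = ℕP.≤-trans
    (prodℕ-≤-^ f (2 ^ ℓ M) (λ i → ℕP.^-monoʳ-≤ 2 (⌊log⌋-mono-≤ 1<b (m⁺ i) (≤-sumℕ m i))))
    (ℕP.≤-trans (ℕP.≤-reflexive swap) (b^⌊log⌋≤ 1<b M (1≤sumℕ m (s≤s z≤n) m⁺)))
    where
    swap : (2 ^ ℓ M) ^ suc d ≡ b ^ ℓ M
    swap = trans (ℕP.^-*-assoc 2 (ℓ M) (suc d))
                 (trans (cong (2 ^_) (ℕP.*-comm (ℓ M) (suc d))) (sym (ℕP.^-*-assoc 2 (suc d) (ℓ M))))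

subsetSum-pred : ∀ {d} (S : Subset d) (cs : Fin d → ℤ) →
                 subsetSum S (λ i → cs i ℤ.- + 1) ≡ subsetSum S cs ℤ.- + ∣ S ∣
subsetSum-pred []          cs = refl
subsetSum-pred (true ∷ S)  cs = trans (cong (λ σ → (cs zero ℤ.- + 1) ℤ.+ σ) (subsetSum-pred S (tail cs)))
                                      (regroup (cs zero) (subsetSum S (tail cs)) (+ ∣ S ∣))
  where
  regroup : ∀ (a σ k : ℤ) → (a ℤ.- + 1) ℤ.+ (σ ℤ.- k) ≡ (a ℤ.+ σ) ℤ.- (+ 1 ℤ.+ k)
  regroup = solve-∀
subsetSum-pred (false ∷ S) cs = subsetSum-pred S (tail cs)

nonNegSubsetSums-pred : ∀ {d} (ss : Fin d → ℤ) s →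
  (∀ (S : Subset d) → Nonempty S → + ∣ S ∣ ℤ.< s ℤ.+ subsetSum S ss) →
  NonNegSubsetSums (s ℤ.- + 1) (λ i → ss i ℤ.- + 1)
nonNegSubsetSums-pred ss s hyp S S≢∅ =
  subst (+ 0 ℤ.≤_) regroup (ℤP.i≤j⇒0≤j-i (ℤP.i<j⇒suc[i]≤j (hyp S S≢∅)))
  where
  σ = subsetSum S ss
  regroup : (s ℤ.+ σ) ℤ.- (+ 1 ℤ.+ + ∣ S ∣) ≡ (s ℤ.- + 1) ℤ.+ subsetSum S (λ i → ss i ℤ.- + 1)
  regroup = trans (solve s σ (+ ∣ S ∣)) (cong (λ σ → (s ℤ.- + 1) ℤ.+ σ) (sym (subsetSum-pred S ss)))
    where
    solve : ∀ (s σ k : ℤ) → (s ℤ.+ σ) ℤ.- (+ 1 ℤ.+ k) ≡ (s ℤ.- + 1) ℤ.+ (σ ℤ.- k)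
    solve = solve-∀

mtTerm-≤-weights : ∀ {d} (ss : Fin d → ℤ) s (m : Fin d → ℕ) → 1 ≤ d →
  NonNegSubsetSums (s ℤ.- + 1) (λ i → ss i ℤ.- + 1) → AllPositive m →
  mtTerm ss s m ℚ.≤ toℚ ((2 ^ d) ^ ℤ.∣ s ℤ.- + 1 ∣) ℚ.* prodℚ (λ i → dyadicWeight (2 ^ d) (m i))
mtTerm-≤-weights {d} ss s m 1≤d sums≥0 m⁺ = begin
  negPowProd m ss ℚ.* negPow M s      ≡⟨ cong₂ ℚ._*_ split-prod (negPow-pred s 1≤M) ⟩
  (A ℚ.* B) ℚ.* (C ℚ.* D)             ≡⟨ *-interchange A B C D ⟩
  (A ℚ.* C) ℚ.* (B ℚ.* D)             ≡⟨ cong ((A ℚ.* C) ℚ.*_) (ℚP.*-comm B D) ⟩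
  (A ℚ.* C) ℚ.* (D ℚ.* B)             ≤⟨ *-mono-≤-0≤ (0≤* A≥0 (inv-nonNeg M)) (0≤* (negPow-nonNeg M s') (negPowProd-nonNeg m ss')) A*C≤W
                                           (negPow-sumℕ-*-negPowProd-≤ s' ss' m sums≥0 m⁺) ⟩
  W ℚ.* Cst                           ≡⟨ ℚP.*-comm W Cst ⟩
  Cst ℚ.* W                           ∎
  where
  open ℚP.≤-Reasoning
  ss' = λ i → ss i ℤ.- + 1
  s' = s ℤ.- + 1
  M = sumℕ m
  1≤M = 1≤sumℕ m 1≤d m⁺
  A = prodℚ (λ i → inv (m i))
  B = negPowProd m ss'
  C = inv M
  D = negPow M s'
  W = prodℚ (λ i → dyadicWeight (2 ^ d) (m i))
  Cst = toℚ ((2 ^ d) ^ ℤ.∣ s' ∣)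
  A≥0 = prodℚ-nonNeg (λ i → inv (m i)) (λ i → inv-nonNeg (m i))
  split-prod : negPowProd m ss ≡ A ℚ.* B
  split-prod = trans (prodℚ-cong (λ i → negPow-pred (ss i) (m⁺ i))) (prodℚ-* (λ i → inv (m i)) (λ i → negPow (m i) (ss' i)))
  A*C≤W : A ℚ.* C ℚ.≤ W
  A*C≤W = ℚP.≤-trans (*-monoˡ-≤-0≤ A A≥0 (inv-sumℕ-≤-prod m 1≤d m⁺))
                     (ℚP.≤-reflexive (sym (prodℚ-* (λ i → inv (m i)) (λ i → inv (2 ^ ⌊log⌋ (2 ^ d) (m i))))))

mtPartial-bounded : ∀ {d} (ss : Fin d → ℤ) s → 1 ≤ d →
  NonNegSubsetSums (s ℤ.- + 1) (λ i → ss i ℤ.- + 1) → ∀ N →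
  mtPartial d ss s N ℚ.≤ toℚ ((2 ^ d) ^ ℤ.∣ s ℤ.- + 1 ∣) ℚ.* prodℚ {d} (λ _ → toℚ (2 ℕ.* 2 ^ d))
mtPartial-bounded {d} ss s 1≤d sums≥0 N = begin
  boxSum d N (mtTerm ss s)                           ≤⟨ boxSum-mono-≤ d N (λ m → mtTerm-≤-weights ss s m 1≤d sums≥0) ⟩
  boxSum d N (λ m → Cst ℚ.* prodℚ (λ i → w (m i)))   ≡⟨ boxSum-*ˡ d N Cst (λ m → prodℚ (λ i → w (m i))) ⟩
  Cst ℚ.* boxSum d N (λ m → prodℚ (λ i → w (m i)))   ≡⟨ cong (Cst ℚ.*_) (boxSum-prod d N (λ _ → w)) ⟩
  Cst ℚ.* prodℚ {d} (λ _ → sumTo N w)                ≤⟨ *-monoˡ-≤-0≤ Cst (toℚ-nonNeg ((2 ^ d) ^ ℤ.∣ s ℤ.- + 1 ∣))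
                                                          (prodℚ-mono-≤ {d} (λ _ → sumTo N w) (λ _ → toℚ (2 ℕ.* 2 ^ d)) (λ _ → sumTo-nonNeg N w (λ x _ → dyadicWeight-nonNeg (2 ^ d) x))
                                                                            (λ _ → sumTo-dyadicWeight-≤ (1<2^ 1≤d) N)) ⟩
  Cst ℚ.* prodℚ {d} (λ _ → toℚ (2 ℕ.* 2 ^ d))        ∎
  where
  open ℚP.≤-Reasoning
  Cst = toℚ ((2 ^ d) ^ ℤ.∣ s ℤ.- + 1 ∣)
  w = dyadicWeight (2 ^ d)

-- Divergence

𝟙 : ∀ {P : Set} → Dec P → ℚ
𝟙 (yes _) = 1ℚ
𝟙 (no  _) = 0ℚ

𝟙-yes : ∀ {P : Set} (P? : Dec P) → P → 𝟙 P? ≡ 1ℚ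
𝟙-yes (yes _) _ = refl
𝟙-yes (no ¬p) p = ⊥-elim (¬p p)

𝟙-no : ∀ {P : Set} (P? : Dec P) → ¬ P → 𝟙 P? ≡ 0ℚ
𝟙-no (yes p) ¬p = ⊥-elim (¬p p)
𝟙-no (no _)  _  = refl

InInterval : ℕ → ℕ → ℕ → Set
InInterval a b x = a ≤ x × x < b

inInterval? : ∀ a b x → Dec (InInterval a b x)
inInterval? a b x = (a ℕ.≤? x) ×-dec (x ℕ.<? b)

sumTo-𝟙-inInterval : ∀ {N a b} → 1 ≤ a → a ≤ b → b ≤ suc N →
                     sumTo N (λ x → 𝟙 (inInterval? a b x)) ≡ toℚ (b ℕ.∸ a)
sumTo-𝟙-inInterval {N} {suc a} {suc b} _ (s≤s a≤b) (s≤s b≤N) = begin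
  sumTo N χ                                                   ≡⟨ cong (λ n → sumTo n χ) (ℕP.m∸n+n≡m b≤N) ⟨
  sumTo ((N ℕ.∸ b) ℕ.+ b) χ                                   ≡⟨ sumTo-split (N ℕ.∸ b) b χ ⟩
  sumTo b χ ℚ.+ sumTo (N ℕ.∸ b) (λ k → χ (k ℕ.+ b))           ≡⟨ cong (sumTo b χ ℚ.+_) (sumTo-0 (N ℕ.∸ b) above) ⟩
  sumTo b χ ℚ.+ 0ℚ                                            ≡⟨ ℚP.+-identityʳ (sumTo b χ) ⟩
  sumTo b χ                                                   ≡⟨ cong (λ n → sumTo n χ) (ℕP.m∸n+n≡m a≤b) ⟨
  sumTo ((b ℕ.∸ a) ℕ.+ a) χ                                   ≡⟨ sumTo-split (b ℕ.∸ a) a χ ⟩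
  sumTo a χ ℚ.+ sumTo (b ℕ.∸ a) (λ k → χ (k ℕ.+ a))           ≡⟨ cong₂ ℚ._+_ (sumTo-0 a below) (sumTo-cong (b ℕ.∸ a) inside) ⟩
  0ℚ ℚ.+ sumTo (b ℕ.∸ a) (λ _ → 1ℚ)                           ≡⟨ ℚP.+-identityˡ _ ⟩
  sumTo (b ℕ.∸ a) (λ _ → 1ℚ)                                  ≡⟨ sumTo-const (b ℕ.∸ a) 1ℚ ⟩
  toℚ (b ℕ.∸ a) ℚ.* 1ℚ                                        ≡⟨ ℚP.*-identityʳ _ ⟩
  toℚ (b ℕ.∸ a)                                               ∎
  where
  open ≡-Reasoning
  χ = λ x → 𝟙 (inInterval? (suc a) (suc b) x)
  below : ∀ x → 1 ≤ x → x ≤ a → χ x ≡ 0ℚ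
  below x _ x≤a = 𝟙-no (inInterval? (suc a) (suc b) x) (λ (a<x , _) → ℕP.<-irrefl refl (ℕP.≤-<-trans x≤a a<x))
  inside : ∀ k → 1 ≤ k → k ≤ b ℕ.∸ a → χ (k ℕ.+ a) ≡ 1ℚ
  inside k 1≤k k≤b-a = 𝟙-yes (inInterval? (suc a) (suc b) (k ℕ.+ a))
    (ℕP.+-monoˡ-≤ a 1≤k , s≤s (ℕP.≤-trans (ℕP.+-monoˡ-≤ a k≤b-a) (ℕP.≤-reflexive (ℕP.m∸n+n≡m a≤b))))
  above : ∀ k → 1 ≤ k → k ≤ N ℕ.∸ b → χ (k ℕ.+ b) ≡ 0ℚ
  above k 1≤k _ = 𝟙-no (inInterval? (suc a) (suc b) (k ℕ.+ b))
    (λ (_ , k+b<b⁺) → ℕP.<-irrefl refl (ℕP.<-≤-trans k+b<b⁺ (ℕP.+-monoˡ-≤ b 1≤k)))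

sumTo-disjoint-≤ : ∀ J (f : ℕ → ℚ) {T} → 0ℚ ℚ.≤ T → (∀ j → f j ℚ.≤ T) →
                   (∀ j j' → j ≢ j' → f j ≡ 0ℚ ⊎ f j' ≡ 0ℚ) → sumTo J f ℚ.≤ T
sumTo-disjoint-≤ zero    f 0≤T f≤T disjoint = 0≤T
sumTo-disjoint-≤ (suc J) f 0≤T f≤T disjoint with f (suc J) ℚP.≟ 0ℚ
... | yes fJ≡0 = ℚP.≤-trans (ℚP.≤-reflexive (trans (cong (sumTo J f ℚ.+_) fJ≡0) (ℚP.+-identityʳ (sumTo J f))))
                            (sumTo-disjoint-≤ J f 0≤T f≤T disjoint)
... | no  fJ≢0 = ℚP.≤-trans (ℚP.≤-reflexive (trans (cong (ℚ._+ f (suc J)) (sumTo-0 J earlier)) (ℚP.+-identityˡ (f (suc J)))))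
                            (f≤T (suc J))
  where
  earlier : ∀ k → 1 ≤ k → k ≤ J → f k ≡ 0ℚ
  earlier k _ k≤J with disjoint k (suc J) (λ k≡J⁺ → ℕP.<-irrefl k≡J⁺ (s≤s k≤J))
  ... | inj₁ fk≡0 = fk≡0
  ... | inj₂ fJ≡0 = ⊥-elim (fJ≢0 fJ≡0)

dyadicBlock : ℕ → ℕ → ℚ
dyadicBlock k x = 𝟙 (inInterval? (2 ^ k) (2 ^ suc k) x)

sumTo-dyadicBlock : ∀ {N} k → 2 ^ suc k ≤ suc N → sumTo N (dyadicBlock k) ≡ toℚ (2 ^ k)
sumTo-dyadicBlock k 2^k⁺≤N⁺ =
  trans (sumTo-𝟙-inInterval (1≤^ k (s≤s z≤n)) (ℕP.m≤m+n (2 ^ k) (2 ^ k ℕ.+ 0)) 2^k⁺≤N⁺)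
        (cong toℚ (trans (ℕP.m+n∸m≡n (2 ^ k) (2 ^ k ℕ.+ 0)) (ℕP.+-identityʳ (2 ^ k))))

dyadicBlock-unique : ∀ {j j' x} → InInterval (2 ^ j) (2 ^ suc j) x → InInterval (2 ^ j') (2 ^ suc j') x → j ≡ j'
dyadicBlock-unique {j} {j'} (2^j≤x , x<2^j⁺) (2^j'≤x , x<2^j'⁺) with ℕP.<-cmp j j'
... | tri≈ _ j≡j' _ = j≡j'
... | tri< j<j' _ _ = ⊥-elim (ℕP.<-irrefl refl (ℕP.<-≤-trans x<2^j⁺ (ℕP.≤-trans (ℕP.^-monoʳ-≤ 2 j<j') 2^j'≤x)))
... | tri> _ _ j'<j = ⊥-elim (ℕP.<-irrefl refl (ℕP.<-≤-trans x<2^j'⁺ (ℕP.≤-trans (ℕP.^-monoʳ-≤ 2 j'<j) 2^j≤x)))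

-- Coordinates outside S are confined to the block [1, 2) = [2^0, 2^1).
level : ∀ {d} → Subset d → ℕ → Fin d → ℕ
level S j i = if lookup S i then j else 0

level-∈ : ∀ {d} (S : Subset d) j {i} → lookup S i ≡ true → level S j i ≡ j
level-∈ S j i∈S = cong (λ b → if b then j else 0) i∈S

level-≤ : ∀ {d} (S : Subset d) j i → level S j i ≤ j
level-≤ S j i with lookup S i
... | true  = ℕP.≤-refl
... | false = z≤n

prodℕ-2^level : ∀ {d} (S : Subset d) j → prodℕ (λ i → 2 ^ level S j i) ≡ (2 ^ j) ^ ∣ S ∣
prodℕ-2^level []          j = refl
prodℕ-2^level (true ∷ S)  j = cong (2 ^ j ℕ.*_) (prodℕ-2^level S j)
prodℕ-2^level (false ∷ S) j = trans (ℕP.+-identityʳ _) (prodℕ-2^level S j)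

prodℚ-negPow-2^level : ∀ {d} (S : Subset d) j (cs : Fin d → ℤ) →
                       prodℚ (λ i → negPow (2 ^ level S j i) (cs i)) ≡ negPow (2 ^ j) (subsetSum S cs)
prodℚ-negPow-2^level []          j cs = refl
prodℚ-negPow-2^level (true ∷ S)  j cs =
  trans (cong (negPow (2 ^ j) (cs zero) ℚ.*_) (prodℚ-negPow-2^level S j (tail cs)))
        (sym (negPow-+ (cs zero) (subsetSum S (tail cs)) (1≤^ j (s≤s z≤n))))
prodℚ-negPow-2^level (false ∷ S) j cs =
  trans (cong₂ ℚ._*_ (negPow-1 (cs zero)) (prodℚ-negPow-2^level S j (tail cs))) (ℚP.*-identityˡ _)

InDyadicBox : ∀ {d} → Subset d → ℕ → (Fin d → ℕ) → Set
InDyadicBox S j m = ∀ i → InInterval (2 ^ level S j i) (2 ^ suc (level S j i)) (m i)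

inDyadicBox? : ∀ {d} (S : Subset d) j m → Dec (InDyadicBox S j m)
inDyadicBox? S j m = all? (λ i → inInterval? (2 ^ level S j i) (2 ^ suc (level S j i)) (m i))

dyadicBox : ∀ {d} → Subset d → ℕ → (Fin d → ℕ) → ℚ
dyadicBox S j m = prodℚ (λ i → dyadicBlock (level S j i) (m i))

dyadicBox-inside : ∀ {d} (S : Subset d) j {m} → InDyadicBox S j m → dyadicBox S j m ≡ 1ℚ
dyadicBox-inside S j {m} m∈B = prodℚ-1 (λ i → dyadicBlock (level S j i) (m i)) (λ i → 𝟙-yes (inInterval? (2 ^ level S j i) (2 ^ suc (level S j i)) (m i)) (m∈B i))

dyadicBox-outside : ∀ {d} (S : Subset d) j {m} → ¬ InDyadicBox S j m → dyadicBox S j m ≡ 0ℚ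
dyadicBox-outside {d} S j {m} m∉B with ¬∀⟶∃¬ d _ (λ i → inInterval? (2 ^ level S j i) (2 ^ suc (level S j i)) (m i)) m∉B
... | i , mᵢ∉Bᵢ = prodℚ-0 (λ i → dyadicBlock (level S j i) (m i)) i (𝟙-no (inInterval? (2 ^ level S j i) (2 ^ suc (level S j i)) (m i)) mᵢ∉Bᵢ)

dyadicBoxes-disjoint : ∀ {d} (S : Subset d) {i₀} → lookup S i₀ ≡ true → ∀ {j j' m} → j ≢ j' →
                       InDyadicBox S j m → ¬ InDyadicBox S j' m
dyadicBoxes-disjoint S {i₀} i₀∈S {j} {j'} j≢j' m∈B m∈B' =
  j≢j' (dyadicBlock-unique (subst (λ k → InInterval (2 ^ k) (2 ^ suc k) _) (level-∈ S j i₀∈S) (m∈B i₀))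
                           (subst (λ k → InInterval (2 ^ k) (2 ^ suc k) _) (level-∈ S j' i₀∈S) (m∈B' i₀)))

boxSum-dyadicBox : ∀ {d} N (S : Subset d) j → 2 ^ suc j ≤ suc N → boxSum d N (dyadicBox S j) ≡ toℚ ((2 ^ j) ^ ∣ S ∣)
boxSum-dyadicBox {d} N S j 2^j⁺≤N⁺ = begin
  boxSum d N (dyadicBox S j)                        ≡⟨ boxSum-prod d N (λ i → dyadicBlock (level S j i)) ⟩
  prodℚ (λ i → sumTo N (dyadicBlock (level S j i))) ≡⟨ prodℚ-cong (λ i → sumTo-dyadicBlock (level S j i) (ℕP.≤-trans (ℕP.^-monoʳ-≤ 2 (s≤s (level-≤ S j i))) 2^j⁺≤N⁺)) ⟩
  prodℚ (λ i → toℚ (2 ^ level S j i))               ≡⟨ prodℚ-toℚ (λ i → 2 ^ level S j i) ⟩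
  toℚ (prodℕ (λ i → 2 ^ level S j i))               ≡⟨ cong toℚ (prodℕ-2^level S j) ⟩
  toℚ ((2 ^ j) ^ ∣ S ∣)                             ∎
  where open ≡-Reasoning

archimedean : ∀ (q : ℚ) → ∃ λ K → q ℚ.< toℚ K
archimedean q@(ℚ.mkℚ n d-1 _) = K , ℚP.toℚᵘ-cancel-< (ℚᵘP.<-respʳ-≃ (ℚᵘP.≃-sym (toℚᵘ-toℚ K)) (ℚᵘ.*<* n*1<K*d))
  where
  K = suc ℤ.∣ n ∣
  n*1<K*d : n ℤ.* + 1 ℤ.< + K ℤ.* + suc d-1
  n*1<K*d = begin-strict
    n ℤ.* + 1           ≡⟨ ℤP.*-identityʳ n ⟩
    n                   ≤⟨ i≤+∣i∣ n ⟩
    + ℤ.∣ n ∣           <⟨ ℤ.+<+ ℕP.≤-refl ⟩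
    + K                 ≤⟨ ℤ.+≤+ (ℕP.m≤m*n K (suc d-1)) ⟩
    + (K ℕ.* suc d-1)   ≡⟨ ℤP.pos-* K (suc d-1) ⟩
    + K ℤ.* + suc d-1   ∎
    where
    open ℤP.≤-Reasoning
    i≤+∣i∣ : ∀ i → i ℤ.≤ + ℤ.∣ i ∣
    i≤+∣i∣ (+ _)      = ℤP.≤-refl
    i≤+∣i∣ -[1+ _ ]   = ℤ.-≤+

module _ {d} (ss : Fin d → ℤ) (s : ℤ) (S : Subset d) {i₀ : Fin d} (i₀∈S : lookup S i₀ ≡ true)
         (s+σ≤∣S∣ : s ℤ.+ subsetSum S ss ℤ.≤ + ∣ S ∣) where

  private
    σ = subsetSum S ss

    -- Q absorbs the losses 2^|s_i| from comparing m_i with 2^(level i) and (2d)^|s| from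
    -- comparing M with 2^j.
    Q : ℕ
    Q = prodℕ (λ i → 2 ^ ℤ.∣ ss i ∣) ℕ.* (2 ℕ.* d) ^ ℤ.∣ s ∣

    1≤d : 1 ≤ d
    1≤d = ℕP.≤-trans (s≤s z≤n) (toℕ<n i₀)

    1≤2d : 1 ≤ 2 ℕ.* d
    1≤2d = ℕP.≤-trans 1≤d (ℕP.m≤n*m d 2)

    1≤Q : 1 ≤ Q
    1≤Q = ℕP.*-mono-≤ (1≤prodℕ _ (λ i → 1≤^ ℤ.∣ ss i ∣ (s≤s z≤n))) (1≤^ ℤ.∣ s ∣ 1≤2d)

    -- A box has (2^j)^|S| points, so it carries total weight 1/Q.
    weight : ℕ → ℚ
    weight j = inv Q ℚ.* inv ((2 ^ j) ^ ∣ S ∣)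

  mtTerm-≥-inDyadicBox : ∀ j m → InDyadicBox S j m → weight j ℚ.≤ mtTerm ss s m
  mtTerm-≥-inDyadicBox j m m∈B = begin
    inv Q ℚ.* inv (y ^ ∣ S ∣)                     ≤⟨ *-monoˡ-≤-0≤ (inv Q) (inv-nonNeg Q) y^-∣S∣≤ ⟩
    inv Q ℚ.* negPow y (σ ℤ.+ s)                  ≡⟨ cong₂ ℚ._*_ inv-Q (negPow-+ σ s 1≤y) ⟩
    (c₁ ℚ.* c₂) ℚ.* (negPow y σ ℚ.* negPow y s)   ≡⟨ *-interchange c₁ c₂ (negPow y σ) (negPow y s) ⟩
    (c₁ ℚ.* negPow y σ) ℚ.* (c₂ ℚ.* negPow y s)   ≤⟨ *-mono-≤-0≤ (0≤* c₁≥0 (negPow-nonNeg y σ)) (0≤* (inv-nonNeg ((2 ℕ.* d) ^ ℤ.∣ s ∣)) (negPow-nonNeg y s)) coordinates sum ⟩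
    negPowProd m ss ℚ.* negPow M s                ∎
    where
    open ℚP.≤-Reasoning
    y = 2 ^ j
    1≤y = 1≤^ j (s≤s z≤n)
    M = sumℕ m
    c₁ = prodℚ (λ i → inv (2 ^ ℤ.∣ ss i ∣))
    c₂ = inv ((2 ℕ.* d) ^ ℤ.∣ s ∣)
    c₁≥0 = prodℚ-nonNeg _ (λ i → inv-nonNeg (2 ^ ℤ.∣ ss i ∣))
    inv-Q : inv Q ≡ c₁ ℚ.* c₂
    inv-Q = trans (inv-* (prodℕ (λ i → 2 ^ ℤ.∣ ss i ∣)) ((2 ℕ.* d) ^ ℤ.∣ s ∣)) (cong (ℚ._* c₂) (sym (prodℚ-inv (λ i → 2 ^ ℤ.∣ ss i ∣))))
    y^-∣S∣≤ : inv (y ^ ∣ S ∣) ℚ.≤ negPow y (σ ℤ.+ s)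
    y^-∣S∣≤ = subst (λ e → negPow y e ℚ.≤ negPow y (σ ℤ.+ s)) gap (negPow-antimonoʳ (σ ℤ.+ s) k 1≤y)
      where
      k = ℤ.∣ + ∣ S ∣ ℤ.- (σ ℤ.+ s) ∣
      gap : (σ ℤ.+ s) ℤ.+ + k ≡ + ∣ S ∣
      gap = trans (cong (λ k → (σ ℤ.+ s) ℤ.+ k) (ℤP.0≤i⇒+∣i∣≡i (ℤP.i≤j⇒0≤j-i (subst (ℤ._≤ + ∣ S ∣) (ℤP.+-comm s σ) s+σ≤∣S∣))))
                  (a+[c-a]≡c (σ ℤ.+ s) (+ ∣ S ∣))
        where
        a+[c-a]≡c : ∀ (a c : ℤ) → a ℤ.+ (c ℤ.- a) ≡ c
        a+[c-a]≡c = solve-∀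
    coordinates : c₁ ℚ.* negPow y σ ℚ.≤ negPowProd m ss
    coordinates = begin
      c₁ ℚ.* negPow y σ                                                 ≡⟨ cong (c₁ ℚ.*_) (prodℚ-negPow-2^level S j ss) ⟨
      c₁ ℚ.* prodℚ (λ i → negPow (2 ^ level S j i) (ss i))              ≡⟨ prodℚ-* (λ i → inv (2 ^ ℤ.∣ ss i ∣)) (λ i → negPow (2 ^ level S j i) (ss i)) ⟨
      prodℚ (λ i → inv (2 ^ ℤ.∣ ss i ∣) ℚ.* negPow (2 ^ level S j i) (ss i))
        ≤⟨ prodℚ-mono-≤ _ _ (λ i → 0≤* (inv-nonNeg (2 ^ ℤ.∣ ss i ∣)) (negPow-nonNeg (2 ^ level S j i) (ss i)))
             (λ i → negPow-≥-scaled {2} (ss i) (s≤s z≤n) (1≤^ (level S j i) (s≤s z≤n)) (proj₁ (m∈B i)) (ℕP.<⇒≤ (proj₂ (m∈B i)))) ⟩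
      negPowProd m ss                                                   ∎
    y≤M : y ≤ M
    y≤M = ℕP.≤-trans (subst (λ k → 2 ^ k ≤ m i₀) (level-∈ S j i₀∈S) (proj₁ (m∈B i₀))) (≤-sumℕ m i₀)
    M≤2dy : M ≤ 2 ℕ.* d ℕ.* y
    M≤2dy = ℕP.≤-trans (sumℕ-≤-* m (2 ℕ.* y) (λ i → ℕP.≤-trans (ℕP.<⇒≤ (proj₂ (m∈B i))) (ℕP.^-monoʳ-≤ 2 (s≤s (level-≤ S j i)))))
                       (ℕP.≤-reflexive (trans (sym (ℕP.*-assoc d 2 y)) (cong (ℕ._* y) (ℕP.*-comm d 2))))
    sum : c₂ ℚ.* negPow y s ℚ.≤ negPow M s
    sum = negPow-≥-scaled s 1≤2d 1≤y y≤M M≤2dy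

  weighted-dyadicBox-≤-mtTerm : ∀ j m → weight j ℚ.* dyadicBox S j m ℚ.≤ mtTerm ss s m
  weighted-dyadicBox-≤-mtTerm j m with inDyadicBox? S j m
  ... | yes m∈B = ℚP.≤-trans (ℚP.≤-reflexive (trans (cong (weight j ℚ.*_) (dyadicBox-inside S j m∈B)) (ℚP.*-identityʳ (weight j))))
                             (mtTerm-≥-inDyadicBox j m m∈B)
  ... | no  m∉B = ℚP.≤-trans (ℚP.≤-reflexive (trans (cong (weight j ℚ.*_) (dyadicBox-outside S j m∉B)) (ℚP.*-zeroʳ (weight j))))
                             (0≤* (negPowProd-nonNeg m ss) (negPow-nonNeg (sumℕ m) s))

  weighted-dyadicBoxes-disjoint : ∀ m j j' → j ≢ j' → weight j ℚ.* dyadicBox S j m ≡ 0ℚ ⊎ weight j' ℚ.* dyadicBox S j' m ≡ 0ℚ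
  weighted-dyadicBoxes-disjoint m j j' j≢j' with inDyadicBox? S j m
  ... | no  m∉B = inj₁ (trans (cong (weight j ℚ.*_) (dyadicBox-outside S j m∉B)) (ℚP.*-zeroʳ (weight j)))
  ... | yes m∈B = inj₂ (trans (cong (weight j' ℚ.*_) (dyadicBox-outside S j' (dyadicBoxes-disjoint S i₀∈S j≢j' m∈B)))
                              (ℚP.*-zeroʳ (weight j')))

  mtPartial-≥ : ∀ J → toℚ J ℚ.* inv Q ℚ.≤ mtPartial d ss s (2 ^ suc J)
  mtPartial-≥ J = begin
    toℚ J ℚ.* inv Q                                       ≡⟨ sumTo-const J (inv Q) ⟨
    sumTo J (λ _ → inv Q)                                 ≡⟨ sumTo-cong J box-weight ⟨
    sumTo J (λ j → weight j ℚ.* boxSum d N (dyadicBox S j)) ≡⟨ sumTo-cong J (λ j _ _ → boxSum-*ˡ d N (weight j) (dyadicBox S j)) ⟨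
    sumTo J (λ j → boxSum d N (λ m → weight j ℚ.* dyadicBox S j m)) ≡⟨ boxSum-sumTo d N J (λ j m → weight j ℚ.* dyadicBox S j m) ⟨
    boxSum d N (λ m → sumTo J (λ j → weight j ℚ.* dyadicBox S j m))
      ≤⟨ boxSum-mono-≤ d N (λ m _ → sumTo-disjoint-≤ J _ (0≤* (negPowProd-nonNeg m ss) (negPow-nonNeg (sumℕ m) s))
                                         (λ j → weighted-dyadicBox-≤-mtTerm j m) (weighted-dyadicBoxes-disjoint m)) ⟩
    boxSum d N (mtTerm ss s)                              ∎
    where
    open ℚP.≤-Reasoning
    N = 2 ^ suc J
    box-weight : ∀ j → 1 ≤ j → j ≤ J → weight j ℚ.* boxSum d N (dyadicBox S j) ≡ inv Q
    box-weight j _ j≤J = begin-equality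
      weight j ℚ.* boxSum d N (dyadicBox S j)                ≡⟨ cong (weight j ℚ.*_) (boxSum-dyadicBox N S j (ℕP.m≤n⇒m≤1+n (ℕP.^-monoʳ-≤ 2 (s≤s j≤J)))) ⟩
      (inv Q ℚ.* inv X) ℚ.* toℚ X                            ≡⟨ ℚP.*-assoc (inv Q) (inv X) (toℚ X) ⟩
      inv Q ℚ.* (inv X ℚ.* toℚ X)                            ≡⟨ cong (inv Q ℚ.*_) (inv*toℚ X (1≤^ ∣ S ∣ (1≤^ j (s≤s z≤n)))) ⟩
      inv Q ℚ.* 1ℚ                                           ≡⟨ ℚP.*-identityʳ (inv Q) ⟩
      inv Q                                                  ∎
      where X = (2 ^ j) ^ ∣ S ∣

  ¬mtConverges : ¬ MTConverges d ss s
  ¬mtConverges (B , partial≤B) with archimedean B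
  ... | K , B<K = ℚP.<-irrefl refl (ℚP.<-≤-trans B<K (begin
    toℚ K                             ≡⟨ K≡J/Q ⟨
    toℚ (K ℕ.* Q) ℚ.* inv Q           ≤⟨ mtPartial-≥ (K ℕ.* Q) ⟩
    mtPartial d ss s (2 ^ suc (K ℕ.* Q)) ≤⟨ partial≤B _ ⟩
    B                                 ∎))
    where
    open ℚP.≤-Reasoning
    K≡J/Q : toℚ (K ℕ.* Q) ℚ.* inv Q ≡ toℚ K
    K≡J/Q = begin-equality
      toℚ (K ℕ.* Q) ℚ.* inv Q          ≡⟨ cong (ℚ._* inv Q) (toℚ-* K Q) ⟩
      (toℚ K ℚ.* toℚ Q) ℚ.* inv Q      ≡⟨ ℚP.*-assoc (toℚ K) (toℚ Q) (inv Q) ⟩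
      toℚ K ℚ.* (toℚ Q ℚ.* inv Q)      ≡⟨ cong (toℚ K ℚ.*_) (toℚ*inv Q 1≤Q) ⟩
      toℚ K ℚ.* 1ℚ                     ≡⟨ ℚP.*-identityʳ (toℚ K) ⟩
      toℚ K                            ∎

proposition2p1 : (d : ℕ) → 1 ≤ d → (ss : Fin d → ℤ) → (s : ℤ) →
    MTConverges d ss s ⇔
      (∀ (S : Subset d) → Nonempty S → (+ ∣ S ∣) ℤ.< s ℤ.+ subsetSum S ss)
proposition2p1 d 1≤d ss s = mk⇔ necessary sufficient
  where
  necessary : MTConverges d ss s → ∀ (S : Subset d) → Nonempty S → + ∣ S ∣ ℤ.< s ℤ.+ subsetSum S ss
  necessary converges S (i₀ , i₀∈S) with + ∣ S ∣ ℤ.<? s ℤ.+ subsetSum S ss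
  ... | yes ∣S∣<s+σ = ∣S∣<s+σ
  ... | no  ∣S∣≮s+σ = ⊥-elim (¬mtConverges ss s S ([]=⇒lookup i₀∈S) (ℤP.≮⇒≥ ∣S∣≮s+σ) converges)

  sufficient : (∀ (S : Subset d) → Nonempty S → + ∣ S ∣ ℤ.< s ℤ.+ subsetSum S ss) → MTConverges d ss s
  sufficient hyp = _ , mtPartial-bounded ss s 1≤d (nonNegSubsetSums-pred ss s hyp)
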